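{- Let $k\ge 2$ and $r\ge 1$, and let $H$ be the star $k$-graph with $r$ spokes: its vertex set is $\{c\}\cup B_1\cup\dots\cup B_r$ with the $B_t$ pairwise disjoint sets of size $k-1$ not containing $c$, and its edges are $\{c\}\cup B_t$ for $t=1,\dots,r$, so that $n=(k-1)r+1$ vertices. Then the spectrum of the Laplacian $L$ of $H$ consists of $0$ and $n$ each with multiplicity one, $1$ with multiplicity $r-1$, and $k$ with multiplicity $(k-2)r$.
   Context: For a hypergraph on $n$ vertices, the adjacency matrix $A=(a_{ij})$ has $a_{ii}=0$ and, for $i\ne j$, $a_{ij}$ equal to the number of edges containing both $i$ and $j$. The Laplacian degree is $\delta_i=\sum_j a_{ij}$ and the Laplacian is $L=\mathrm{diag}(\delta_1,\dots,\delta_n)-A$. -}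

module Defs where

open import Data.Nat as ℕ using (ℕ; zero; suc; _∸_; _≤ᵇ_; _<ᵇ_)
open import Data.Fin using (Fin; zero; suc; toℕ; punchIn; _≟_)
open import Data.Bool using (Bool; true; false; if_then_else_; _∧_; _∨_)
open import Data.List using (List; []; _∷_; map)
open import Data.List.Base using (allFin)
open import Data.Integer using (ℤ; +_; _+_; _-_; _*_; -_)
open import Relation.Nullary.Decidable using (⌊_⌋)

Matrix : ℕ → Set
Matrix n = Fin n → Fin n → ℤ

∑ : (n : ℕ) → (Fin n → ℤ) → ℤ
∑ zero    f = + 0
∑ (suc n) f = f zero + ∑ n (λ i → f (suc i))

record Hypergraph (n : ℕ) : Set where
  field
    edges : List (Fin n → Bool)
open Hypergraph public


count : {n : ℕ} → ((Fin n → Bool) → Bool) → List (Fin n → Bool) → ℕ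
count p []       = 0
count p (e ∷ es) = if p e then suc (count p es) else count p es

adjacency : {n : ℕ} → Hypergraph n → Matrix n
adjacency H i j =
  if ⌊ i ≟ j ⌋ then + 0 else + count (λ e → e i ∧ e j) (edges H)

lapDegree : {n : ℕ} → Hypergraph n → Fin n → ℤ
lapDegree {n} H i = ∑ n (λ j → adjacency H i j)

laplacian : {n : ℕ} → Hypergraph n → Matrix n
laplacian H i j =
  (if ⌊ i ≟ j ⌋ then lapDegree H i else + 0) - adjacency H i j

sign : ℕ → ℤ
sign zero          = + 1
sign (suc zero)    = - (+ 1)
sign (suc (suc m)) = sign m

det : (n : ℕ) → Matrix n → ℤ
det zero    M = + 1
det (suc n) M =
  ∑ (suc n) (λ j → sign (toℕ j) * M zero j
                    * det n (λ a b → M (suc a) (punchIn j b)))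

charPoly : {n : ℕ} → Matrix n → ℤ → ℤ
charPoly {n} M x =
  det n (λ i j → (if ⌊ i ≟ j ⌋ then x else + 0) - M i j)

-- The star k-graph with r spokes on n = (k-1) r + 1 vertices Fin n.
-- Centre c = vertex 0; spoke B_t (t = 0..r-1) = vertices v with
-- t(k-1) < v ≤ (t+1)(k-1).
starVertices : ℕ → ℕ → ℕ
starVertices k r = suc ((k ∸ 1) ℕ.* r)

starEdge : (k r : ℕ) → Fin r → Fin (starVertices k r) → Bool
starEdge k r t zero    = true
starEdge k r t (suc v) =
  (toℕ t ℕ.* (k ∸ 1) ≤ᵇ toℕ v) ∧ (toℕ v <ᵇ suc (toℕ t) ℕ.* (k ∸ 1))

star : (k r : ℕ) → Hypergraph (starVertices k r)
star k r = record { edges = map (starEdge k r) (allFin r) }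

-- Write m = k − 1 for the number of vertices on a spoke, N = m·r and
-- n = N + 1.  The characteristic matrix xI − L has x − N at the centre, 1
-- between the centre and each spoke vertex, and a·δ + [same spoke] among the
-- spoke vertices, where a = x − k.  Its determinant (cofactor expansion along
-- row 0, as in Defs) is computed by column operations over ℤ, never dividing:
--   1. subtract from every non-tip column of a spoke the next column of the
--      spoke and take out a, leaving path columns e_j − e_{j+1}: a^((k−2)r);
--   2. clear each tip (outermost) column with ramp weights, leaving
--      e_0 + c·e_j where c = x − 1;
--   3. subtract from each tip but the last the next tip and c times the path
--      columns between them, and take out c: c^(r−1);
--   4. what remains has path columns between two outer columns and its
--      determinant is (x − N)(x − 1) − N = x (x − n).

module Submission where

open import Defs
open import Data.Nat using (ℕ; _≤_; _∸_)
open import Data.Integer using (ℤ; +_; _-_; _*_; _^_)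
open import Relation.Binary.PropositionalEquality using (_≡_)

open import Data.Nat as ℕ using (zero; suc; _<_; _≡ᵇ_; _<ᵇ_; _≤ᵇ_; z≤n; s≤s)
import Data.Nat.Properties as ℕP
open import Data.Integer using (_+_; -_)
import Data.Integer.Properties as ℤP
open import Data.Integer.Tactic.RingSolver using (solve-∀)
open import Data.Bool using (Bool; true; false; if_then_else_; _∧_; not; T)
open import Data.Unit using (tt)
open import Data.Fin as F using (Fin; toℕ; punchIn)
import Data.Fin.Properties as FP
open import Data.List using (tabulate)
open import Data.Bool.Properties using (∧-zeroʳ; ∧-identityʳ)
open import Data.List.Properties using (map-tabulate)
open import Data.Nat.DivMod
  using (_/_; _%_; m≡m%n+[m/n]*n; m%n<n; m<n⇒m/n≡0; m<n*o⇒m/o<n; m/n≡1+[m∸n]/n; +-distrib-/-∣ʳ;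
         m*n/n≡m; m/n*n≤m; /-monoˡ-≤; [m+kn]%n≡m%n; [m+n]%n≡m%n; m<n⇒m%n≡m; m*n%n≡0; n%n≡0)
open import Data.Nat.Divisibility using (n∣m*n)
open import Data.Empty using (⊥-elim)
open import Function using (_∘_)
open import Relation.Nullary using (yes; no)
open import Data.Sum using (_⊎_; inj₁; inj₂)
open import Data.Product using (_×_; _,_; proj₁; proj₂)
open import Relation.Binary.Definitions using (tri<; tri≈; tri>)
open import Relation.Nullary.Decidable using (⌊_⌋; dec-true; dec-false)
open import Relation.Binary.PropositionalEquality
  using (refl; sym; trans; cong; cong₂; subst; subst₂; _≢_; module ≡-Reasoning)

-- Boolean comparisons on ℕ.  `m ≡ᵇ n` and `m <ᵇ n` are definitionally the
-- `does` parts of the standard decision procedures, so their values follow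
-- from `dec-true` / `dec-false`.

≡ᵇ-true : ∀ {m n} → m ≡ n → (m ≡ᵇ n) ≡ true
≡ᵇ-true {m} {n} = dec-true (m ℕP.≟ n)

≡ᵇ-false : ∀ {m n} → m ≢ n → (m ≡ᵇ n) ≡ false
≡ᵇ-false {m} {n} = dec-false (m ℕP.≟ n)

<ᵇ-true : ∀ {m n} → m < n → (m <ᵇ n) ≡ true
<ᵇ-true {m} {n} = dec-true (m ℕP.<? n)

<ᵇ-false : ∀ {m n} → n ≤ m → (m <ᵇ n) ≡ false
<ᵇ-false {m} {n} n≤m = dec-false (m ℕP.<? n) (ℕP.≤⇒≯ n≤m)

≡ᵇ-sound : ∀ {m n} → (m ≡ᵇ n) ≡ true → m ≡ n
≡ᵇ-sound {m} {n} e = ℕP.≡ᵇ⇒≡ m n (subst T (sym e) tt)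

<ᵇ-sound : ∀ {m n} → (m <ᵇ n) ≡ true → m < n
<ᵇ-sound {m} {n} e = ℕP.<ᵇ⇒< m n (subst T (sym e) tt)

≤ᵇ-true : ∀ {m n} → m ≤ n → (m ≤ᵇ n) ≡ true
≤ᵇ-true {m} {n} = dec-true (m ℕP.≤? n)

≤ᵇ-false : ∀ {m n} → n < m → (m ≤ᵇ n) ≡ false
≤ᵇ-false {m} {n} n<m = dec-false (m ℕP.≤? n) (ℕP.<⇒≱ n<m)

<ᵇ-suc : ∀ j K → j ≢ K → (j <ᵇ suc K) ≡ (j <ᵇ K)
<ᵇ-suc zero    zero    ne = ⊥-elim (ne refl)
<ᵇ-suc zero    (suc K) ne = refl
<ᵇ-suc (suc j) zero    ne = refl
<ᵇ-suc (suc j) (suc K) ne = <ᵇ-suc j K (λ e → ne (cong suc e))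

<ᵇ-self : ∀ K → (K <ᵇ K) ≡ false
<ᵇ-self K = <ᵇ-false {K} ℕP.≤-refl

<ᵇ-suc-self : ∀ K → (K <ᵇ suc K) ≡ true
<ᵇ-suc-self K = <ᵇ-true (ℕP.n<1+n K)

true≢false : true ≢ false
true≢false ()

∧-elimʳ : ∀ b {b′} → b ∧ b′ ≡ true → b′ ≡ true
∧-elimʳ true  e = e

δ : ℕ → ℕ → ℤ
δ i j = if i ≡ᵇ j then + 1 else + 0

δ-same : ∀ i → δ i i ≡ + 1
δ-same i rewrite ≡ᵇ-true {i} refl = refl

δ-other : ∀ {i j} → i ≢ j → δ i j ≡ + 0
δ-other ne rewrite ≡ᵇ-false ne = refl

δ-sym : ∀ i j → δ i j ≡ δ j i
δ-sym i j with i ℕP.≟ j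
... | yes refl = refl
... | no ne = trans (δ-other ne) (sym (δ-other (λ e → ne (sym e))))

sum : ℕ → (ℕ → ℤ) → ℤ
sum zero    g = + 0
sum (suc n) g = g 0 + sum n (λ j → g (suc j))

prod : ℕ → (ℕ → ℤ) → ℤ
prod zero    g = + 1
prod (suc n) g = g 0 * prod n (λ j → g (suc j))

sum-cong : ∀ n {g h : ℕ → ℤ} → (∀ j → j < n → g j ≡ h j) → sum n g ≡ sum n h
sum-cong zero    e = refl
sum-cong (suc n) e = cong₂ _+_ (e 0 (s≤s z≤n)) (sum-cong n (λ j p → e (suc j) (s≤s p)))

prod-cong : ∀ n {g h : ℕ → ℤ} → (∀ j → j < n → g j ≡ h j) → prod n g ≡ prod n h
prod-cong zero    e = refl
prod-cong (suc n) e = cong₂ _*_ (e 0 (s≤s z≤n)) (prod-cong n (λ j p → e (suc j) (s≤s p)))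

sum-+ : ∀ n (g h : ℕ → ℤ) → sum n (λ j → g j + h j) ≡ sum n g + sum n h
sum-+ zero    g h = refl
sum-+ (suc n) g h =
  trans (cong (λ s → (g 0 + h 0) + s) (sum-+ n _ _)) (interchange (g 0) (h 0) _ _)
  where interchange : ∀ a b c d → (a + b) + (c + d) ≡ (a + c) + (b + d)
        interchange = solve-∀

sum-scale : ∀ n c (g : ℕ → ℤ) → sum n (λ j → c * g j) ≡ c * sum n g
sum-scale zero    c g = sym (ℤP.*-zeroʳ c)
sum-scale (suc n) c g =
  trans (cong (λ s → c * g 0 + s) (sum-scale n c _)) (sym (ℤP.*-distribˡ-+ c (g 0) _))

sum-neg : ∀ n (g : ℕ → ℤ) → sum n (λ j → - g j) ≡ - sum n g
sum-neg zero    g = refl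
sum-neg (suc n) g =
  trans (cong (λ s → - g 0 + s) (sum-neg n _)) (sym (ℤP.neg-distrib-+ (g 0) _))

sum-zero : ∀ n {g : ℕ → ℤ} → (∀ j → j < n → g j ≡ + 0) → sum n g ≡ + 0
sum-zero zero    z = refl
sum-zero (suc n) z = cong₂ _+_ (z 0 (s≤s z≤n)) (sum-zero n (λ j p → z (suc j) (s≤s p)))

sum-snoc : ∀ n (g : ℕ → ℤ) → sum (suc n) g ≡ sum n g + g n
sum-snoc zero    g = ℤP.+-comm (g 0) (+ 0)
sum-snoc (suc n) g =
  trans (cong (λ s → g 0 + s) (sum-snoc n _)) (sym (ℤP.+-assoc (g 0) _ _))

prod-snoc : ∀ n (g : ℕ → ℤ) → prod (suc n) g ≡ prod n g * g n
prod-snoc zero    g = ℤP.*-comm (g 0) (+ 1)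
prod-snoc (suc n) g =
  trans (cong (g 0 *_) (prod-snoc n _)) (sym (ℤP.*-assoc (g 0) _ _))

sum-split : ∀ a b (g : ℕ → ℤ) → sum (a ℕ.+ b) g ≡ sum a g + sum b (λ j → g (a ℕ.+ j))
sum-split zero    b g = sym (ℤP.+-identityˡ _)
sum-split (suc a) b g =
  trans (cong (λ s → g 0 + s) (sum-split a b _)) (sym (ℤP.+-assoc (g 0) _ _))

prod-split : ∀ a b (g : ℕ → ℤ) → prod (a ℕ.+ b) g ≡ prod a g * prod b (λ j → g (a ℕ.+ j))
prod-split zero    b g = sym (ℤP.*-identityˡ _)
prod-split (suc a) b g =
  trans (cong (g 0 *_) (prod-split a b _)) (sym (ℤP.*-assoc (g 0) _ _))

sum-ones : ∀ n → sum n (λ _ → + 1) ≡ + n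
sum-ones zero    = refl
sum-ones (suc n) = cong (λ s → + 1 + s) (sum-ones n)

prod-const : ∀ n c → prod n (λ _ → c) ≡ c ^ n
prod-const zero    c = refl
prod-const (suc n) c = cong (c *_) (prod-const n c)

prod-periodic : ∀ m R (g : ℕ → ℤ) → (∀ j → g (m ℕ.+ j) ≡ g j) →
  prod (R ℕ.* m) g ≡ prod m g ^ R
prod-periodic m zero    g per = refl
prod-periodic m (suc R) g per =
  trans (prod-split m (R ℕ.* m) g)
    (cong (prod m g *_) (trans (prod-cong (R ℕ.* m) (λ j _ → per j)) (prod-periodic m R g per)))

sum-single : ∀ n w (g : ℕ → ℤ) → w < n → (∀ j → j < n → j ≢ w → g j ≡ + 0) →
  sum n g ≡ g w
sum-single (suc n) zero    g _       z =
  trans (cong (λ s → g 0 + s) (sum-zero n (λ j p → z (suc j) (s≤s p) (λ ())))) (ℤP.+-identityʳ _)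
sum-single (suc n) (suc w) g (s≤s p) z =
  trans (cong (_+ sum n (λ j → g (suc j))) (z 0 (s≤s z≤n) (λ ())))
    (trans (ℤP.+-identityˡ _)
      (sum-single n w _ p (λ j q ne → z (suc j) (s≤s q) (λ e → ne (ℕP.suc-injective e)))))

sum-δ : ∀ n w (g : ℕ → ℤ) → w < n → sum n (λ j → δ j w * g j) ≡ g w
sum-δ n w g p =
  trans (sum-single n w _ p (λ j _ ne → cong (_* g j) (δ-other ne)))
    (trans (cong (_* g w) (δ-same w)) (ℤP.*-identityˡ (g w)))

sum-minus-δ : ∀ n w (g : ℕ → ℤ) → w < n → sum n (λ j → - δ j w * g j) ≡ - g w
sum-minus-δ n w g p =
  trans (sum-cong n (λ j _ → sym (ℤP.neg-distribˡ-* (δ j w) (g j))))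
    (trans (sum-neg n (λ j → δ j w * g j)) (cong -_ (sum-δ n w g p)))

-- A determinant
-- of size n only reads the top-left n × n block of an `Array`; working over ℕ
-- rather than Fin n keeps minors and column arithmetic free of dependent
-- types.  `detℕ` mirrors `Defs.det` (expansion along the first row).

Array : Set
Array = ℕ → ℕ → ℤ

punchInℕ : ℕ → ℕ → ℕ
punchInℕ zero    b       = suc b
punchInℕ (suc j) zero    = zero
punchInℕ (suc j) (suc b) = suc (punchInℕ j b)

punchOutℕ : ℕ → ℕ → ℕ
punchOutℕ zero    c       = ℕ.pred c
punchOutℕ (suc j) zero    = zero
punchOutℕ (suc j) (suc c) = suc (punchOutℕ j c)

punchIn-punchOut : ∀ j c → c ≢ j → punchInℕ j (punchOutℕ j c) ≡ c
punchIn-punchOut zero    zero    ne = ⊥-elim (ne refl)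
punchIn-punchOut zero    (suc c) ne = refl
punchIn-punchOut (suc j) zero    ne = refl
punchIn-punchOut (suc j) (suc c) ne = cong suc (punchIn-punchOut j c (λ e → ne (cong suc e)))

punchOut-punchIn : ∀ j b → punchOutℕ j (punchInℕ j b) ≡ b
punchOut-punchIn zero    b       = refl
punchOut-punchIn (suc j) zero    = refl
punchOut-punchIn (suc j) (suc b) = cong suc (punchOut-punchIn j b)

punchIn≢ : ∀ j b → punchInℕ j b ≢ j
punchIn≢ zero    b       ()
punchIn≢ (suc j) zero    ()
punchIn≢ (suc j) (suc b) e = punchIn≢ j b (ℕP.suc-injective e)

punchIn-< : ∀ {n} j b → b < n → punchInℕ j b < suc n
punchIn-< zero    b       p       = s≤s p
punchIn-< (suc j) zero    p       = s≤s z≤n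
punchIn-< (suc j) (suc b) (s≤s p) = s≤s (punchIn-< j b p)

punchIn-below : ∀ j b → b < j → punchInℕ j b ≡ b
punchIn-below (suc j) zero    _       = refl
punchIn-below (suc j) (suc b) (s≤s p) = cong suc (punchIn-below j b p)

punchOut-< : ∀ n j c → c ≢ j → c < suc n → j < suc n → punchOutℕ j c < n
punchOut-< n       zero    zero    ne _       _       = ⊥-elim (ne refl)
punchOut-< n       zero    (suc c) ne (s≤s p) _       = p
punchOut-< (suc n) (suc j) zero    ne _       _       = s≤s z≤n
punchOut-< zero    (suc j) zero    ne _       (s≤s ())
punchOut-< (suc n) (suc j) (suc c) ne (s≤s p) (s≤s q) =
  s≤s (punchOut-< n j c (λ e → ne (cong suc e)) p q)
punchOut-< zero    (suc j) (suc c) ne (s≤s ()) _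

punchOut-suc : ∀ j c → j ≢ c → j ≢ suc c → punchOutℕ j (suc c) ≡ suc (punchOutℕ j c)
punchOut-suc zero    zero    n1 n2 = ⊥-elim (n1 refl)
punchOut-suc zero    (suc c) n1 n2 = refl
punchOut-suc (suc zero)    zero n1 n2 = ⊥-elim (n2 refl)
punchOut-suc (suc (suc j)) zero n1 n2 = refl
punchOut-suc (suc j) (suc c) n1 n2 =
  cong suc (punchOut-suc j c (λ e → n1 (cong suc e)) (λ e → n2 (cong suc e)))

punchIn-adjacent : ∀ (F : ℕ → ℤ) c b → F c ≡ F (suc c) →
  F (punchInℕ c b) ≡ F (punchInℕ (suc c) b)
punchIn-adjacent F zero    zero    e = sym e
punchIn-adjacent F zero    (suc b) e = refl
punchIn-adjacent F (suc c) zero    e = refl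
punchIn-adjacent F (suc c) (suc b) e = punchIn-adjacent (λ z → F (suc z)) c b e

minorℕ : Array → ℕ → Array
minorℕ f j a b = f (suc a) (punchInℕ j b)

detℕ : ℕ → Array → ℤ
term : ℕ → Array → ℕ → ℤ

detℕ zero    f = + 1
detℕ (suc n) f = sum (suc n) (term n f)

term n f j = sign j * f 0 j * detℕ n (minorℕ f j)

det-cong : ∀ n {f g : Array} → (∀ i j → i < n → j < n → f i j ≡ g i j) →
  detℕ n f ≡ detℕ n g
det-cong zero    e = refl
det-cong (suc n) e = sum-cong (suc n) λ j p →
  cong₂ (λ u v → sign j * u * v) (e 0 j (s≤s z≤n) p)
    (det-cong n (λ a b pa pb → e (suc a) (punchInℕ j b) (s≤s pa) (punchIn-< j b pb)))

toℕ-punchIn : ∀ {n} (j : Fin (suc n)) (b : Fin n) → toℕ (punchIn j b) ≡ punchInℕ (toℕ j) (toℕ b)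
toℕ-punchIn F.zero    b         = refl
toℕ-punchIn (F.suc j) F.zero    = refl
toℕ-punchIn (F.suc j) (F.suc b) = cong suc (toℕ-punchIn j b)

∑≡sum : ∀ n {g : Fin n → ℤ} (G : ℕ → ℤ) → (∀ j → g j ≡ G (toℕ j)) → ∑ n g ≡ sum n G
∑≡sum zero    G e = refl
∑≡sum (suc n) G e = cong₂ _+_ (e F.zero) (∑≡sum n (λ j → G (suc j)) (λ j → e (F.suc j)))

det≡detℕ : ∀ n (M : Matrix n) (f : Array) → (∀ i j → M i j ≡ f (toℕ i) (toℕ j)) →
  det n M ≡ detℕ n f
det≡detℕ zero    M f e = refl
det≡detℕ (suc n) M f e = ∑≡sum (suc n) (term n f) λ j →
  cong₂ (λ u v → sign (toℕ j) * u * v) (e F.zero j)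
    (det≡detℕ n _ (minorℕ f (toℕ j)) λ a b →
      trans (e (F.suc a) (punchIn j b)) (cong (f (suc (toℕ a))) (toℕ-punchIn j b)))

sign-suc : ∀ n → sign (suc n) ≡ - sign n
sign-suc zero          = refl
sign-suc (suc zero)    = refl
sign-suc (suc (suc n)) = sign-suc n

sign-square : ∀ n → sign n * sign n ≡ + 1
sign-square zero          = refl
sign-square (suc zero)    = refl
sign-square (suc (suc n)) = sign-square n

-- Each lemma is proved by induction on the size: in the
-- expansion along row 0, the term at column c is handled directly and every
-- other term is an instance of the same statement for a minor, in which
-- column c has moved to position `punchOutℕ j c`.

AgreeOff : ℕ → Array → Array → Set
AgreeOff c h f = ∀ i j → j ≢ c → h i j ≡ f i j

minor-at : ∀ n {c h f} → AgreeOff c h f → detℕ n (minorℕ h c) ≡ detℕ n (minorℕ f c)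
minor-at n {c} hf = det-cong n (λ a b _ _ → hf (suc a) (punchInℕ c b) (punchIn≢ c b))

minor-off : ∀ {c h f j} → AgreeOff c h f → AgreeOff (punchOutℕ j c) (minorℕ h j) (minorℕ f j)
minor-off {c} {j = j} hf a b nb =
  hf (suc a) (punchInℕ j b) (λ e → nb (trans (sym (punchOut-punchIn j b)) (cong (punchOutℕ j) e)))

column-in-minor : ∀ {j c} (P : ℕ → Set) → c ≢ j → P c → P (punchInℕ j (punchOutℕ j c))
column-in-minor P ne pc = subst P (sym (punchIn-punchOut _ _ ne)) pc

det-additive : ∀ n {c} (f g h : Array) → c < n →
  (∀ i → h i c ≡ f i c + g i c) → AgreeOff c h f → AgreeOff c g f →
  detℕ n h ≡ detℕ n f + detℕ n g
det-additive (suc n) {c} f g h p hc hf gf =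
  trans (sum-cong (suc n) termwise) (sum-+ (suc n) (term n f) (term n g))
  where
  distribˡ : ∀ s a b d → s * (a + b) * d ≡ s * a * d + s * b * d
  distribˡ = solve-∀
  distribʳ : ∀ s a d e → s * a * (d + e) ≡ s * a * d + s * a * e
  distribʳ = solve-∀
  termwise : ∀ j → j < suc n → term n h j ≡ term n f j + term n g j
  termwise j q with j ℕP.≟ c
  ... | yes refl = begin
    sign j * h 0 j * detℕ n (minorℕ h j)
      ≡⟨ cong₂ (λ u v → sign j * u * v) (hc 0) (minor-at n hf) ⟩
    sign j * (f 0 j + g 0 j) * detℕ n (minorℕ f j)
      ≡⟨ distribˡ (sign j) (f 0 j) (g 0 j) _ ⟩
    sign j * f 0 j * detℕ n (minorℕ f j) + sign j * g 0 j * detℕ n (minorℕ f j)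
      ≡⟨ cong (λ v → sign j * f 0 j * detℕ n (minorℕ f j) + sign j * g 0 j * v)
           (sym (minor-at n gf)) ⟩
    sign j * f 0 j * detℕ n (minorℕ f j) + sign j * g 0 j * detℕ n (minorℕ g j) ∎
    where open ≡-Reasoning
  ... | no ne = begin
    sign j * h 0 j * detℕ n (minorℕ h j)
      ≡⟨ cong₂ (λ u v → sign j * u * v) (hf 0 j ne)
           (det-additive n (minorℕ f j) (minorℕ g j) (minorℕ h j)
              (punchOut-< n j c (λ e → ne (sym e)) p q)
              (λ a → column-in-minor (λ z → h (suc a) z ≡ f (suc a) z + g (suc a) z)
                       (λ e → ne (sym e)) (hc (suc a)))
              (minor-off hf) (minor-off gf)) ⟩
    sign j * f 0 j * (detℕ n (minorℕ f j) + detℕ n (minorℕ g j))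
      ≡⟨ distribʳ (sign j) (f 0 j) _ _ ⟩
    sign j * f 0 j * detℕ n (minorℕ f j) + sign j * f 0 j * detℕ n (minorℕ g j)
      ≡⟨ cong (λ u → sign j * f 0 j * detℕ n (minorℕ f j) + sign j * u * detℕ n (minorℕ g j))
           (sym (gf 0 j ne)) ⟩
    sign j * f 0 j * detℕ n (minorℕ f j) + sign j * g 0 j * detℕ n (minorℕ g j) ∎
    where open ≡-Reasoning

det-scale : ∀ n {c} s (f h : Array) → c < n →
  (∀ i → h i c ≡ s * f i c) → AgreeOff c h f → detℕ n h ≡ s * detℕ n f
det-scale (suc n) {c} s f h p hc hf = trans (sum-cong (suc n) termwise) (sum-scale (suc n) s (term n f))
  where
  pull₁ : ∀ s t a d → t * (s * a) * d ≡ s * (t * a * d)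
  pull₁ = solve-∀
  pull₂ : ∀ s t a d → t * a * (s * d) ≡ s * (t * a * d)
  pull₂ = solve-∀
  termwise : ∀ j → j < suc n → term n h j ≡ s * term n f j
  termwise j q with j ℕP.≟ c
  ... | yes refl =
    trans (cong₂ (λ u v → sign j * u * v) (hc 0) (minor-at n hf)) (pull₁ s (sign j) (f 0 j) _)
  ... | no ne =
    trans (cong₂ (λ u v → sign j * u * v) (hf 0 j ne)
            (det-scale n s (minorℕ f j) (minorℕ h j) (punchOut-< n j c (λ e → ne (sym e)) p q)
               (λ a → column-in-minor (λ z → h (suc a) z ≡ s * f (suc a) z)
                        (λ e → ne (sym e)) (hc (suc a)))
               (minor-off hf)))
      (pull₂ s (sign j) (f 0 j) _)

det-zero-column : ∀ n {c} (f : Array) → c < n → (∀ i → f i c ≡ + 0) → detℕ n f ≡ + 0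
det-zero-column n f p z = det-scale n (+ 0) f f p z (λ _ _ _ → refl)

sum-pair-cancel : ∀ n c (t : ℕ → ℤ) → suc c < n →
  (∀ j → j < n → j ≢ c → j ≢ suc c → t j ≡ + 0) → t c + t (suc c) ≡ + 0 → sum n t ≡ + 0
sum-pair-cancel (suc (suc n)) zero t p z e =
  trans (sym (ℤP.+-assoc (t 0) (t 1) _))
    (cong₂ _+_ e (sum-zero n (λ j q → z (suc (suc j)) (s≤s (s≤s q)) (λ ()) (λ ()))))
sum-pair-cancel (suc n) (suc c) t (s≤s p) z e =
  cong₂ _+_ (z 0 (s≤s z≤n) (λ ()) (λ ()))
    (sum-pair-cancel n c (λ j → t (suc j)) p
       (λ j q n1 n2 → z (suc j) (s≤s q) (n1 ∘ ℕP.suc-injective) (n2 ∘ ℕP.suc-injective)) e)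

-- Two equal adjacent columns make the determinant vanish: the terms at c and
-- suc c of the expansion have the same minor and opposite signs, and every
-- other minor again has two equal adjacent columns.
det-adjacent-equal : ∀ n {c} (f : Array) → suc c < n → (∀ i → f i c ≡ f i (suc c)) →
  detℕ n f ≡ + 0
det-adjacent-equal (suc n) {c} f p e = sum-pair-cancel (suc n) c (term n f) p others pair
  where
  others : ∀ j → j < suc n → j ≢ c → j ≢ suc c → term n f j ≡ + 0
  others j q n1 n2 =
    trans (cong (sign j * f 0 j *_) (det-adjacent-equal n (minorℕ f j) bound columns))
          (ℤP.*-zeroʳ (sign j * f 0 j))
    where
    c′ = punchOutℕ j c
    moved : punchOutℕ j (suc c) ≡ suc c′
    moved = punchOut-suc j c n1 n2
    bound : suc c′ < n
    bound = subst (_< n) moved (punchOut-< n j (suc c) (n2 ∘ sym) p q)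
    columns : ∀ a → minorℕ f j a c′ ≡ minorℕ f j a (suc c′)
    columns a = begin
      f (suc a) (punchInℕ j c′)                     ≡⟨ cong (f (suc a)) (punchIn-punchOut j c (n1 ∘ sym)) ⟩
      f (suc a) c                                   ≡⟨ e (suc a) ⟩
      f (suc a) (suc c)                             ≡⟨ cong (f (suc a)) (sym (punchIn-punchOut j (suc c) (n2 ∘ sym))) ⟩
      f (suc a) (punchInℕ j (punchOutℕ j (suc c)))  ≡⟨ cong (λ z → f (suc a) (punchInℕ j z)) moved ⟩
      f (suc a) (punchInℕ j (suc c′)) ∎
      where open ≡-Reasoning
  cancel : ∀ s a d → s * a * d + - s * a * d ≡ + 0
  cancel = solve-∀
  pair : term n f c + term n f (suc c) ≡ + 0
  pair = begin
    term n f c + sign (suc c) * f 0 (suc c) * detℕ n (minorℕ f (suc c))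
      ≡⟨ cong₂ (λ s v → term n f c + s * f 0 (suc c) * v) (sign-suc c)
           (det-cong n (λ a b _ _ → sym (punchIn-adjacent (f (suc a)) c b (e (suc a))))) ⟩
    term n f c + - sign c * f 0 (suc c) * detℕ n (minorℕ f c)
      ≡⟨ cong (λ u → term n f c + - sign c * u * detℕ n (minorℕ f c)) (sym (e 0)) ⟩
    term n f c + - sign c * f 0 c * detℕ n (minorℕ f c)
      ≡⟨ cancel (sign c) (f 0 c) _ ⟩
    + 0 ∎
    where open ≡-Reasoning

setColumn : Array → ℕ → (ℕ → ℤ) → Array
setColumn f c u i j = if j ≡ᵇ c then u i else f i j

setColumn-at : ∀ f c u i → setColumn f c u i c ≡ u i
setColumn-at f c u i rewrite ≡ᵇ-true {c} refl = refl

setColumn-off : ∀ f c u → AgreeOff c (setColumn f c u) f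
setColumn-off f c u i j ne rewrite ≡ᵇ-false ne = refl

-- With
-- G u v the array f with columns e, suc e replaced by u, v, expand the
-- vanishing determinant of G (p + q) (p + q) by additivity in both columns;
-- G p p and G q q vanish as well.
det-swap-adjacent : ∀ n e (f f′ : Array) → suc e < n →
  (∀ i → f′ i e ≡ f i (suc e)) → (∀ i → f′ i (suc e) ≡ f i e) →
  (∀ i j → j ≢ e → j ≢ suc e → f′ i j ≡ f i j) →
  detℕ n f′ + detℕ n f ≡ + 0
det-swap-adjacent n e f f′ p swap₁ swap₂ rest = begin
  detℕ n f′ + detℕ n f
    ≡⟨ cong₂ _+_ (sym (matches f′ swap₁ swap₂ rest))
                 (sym (matches f (λ _ → refl) (λ _ → refl) (λ _ _ _ _ → refl))) ⟩
  detℕ n (G q′ p′) + detℕ n (G p′ q′)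
    ≡⟨ rearrange (detℕ n (G p′ p′)) _ (detℕ n (G q′ p′)) (detℕ n (G q′ q′))
                 (degenerate p′) (degenerate q′) ⟩
  detℕ n (G p′ p′) + detℕ n (G p′ q′) + (detℕ n (G q′ p′) + detℕ n (G q′ q′))
    ≡⟨ sym (trans (additive-first pq) (cong₂ _+_ (additive-second p′) (additive-second q′))) ⟩
  detℕ n (G pq pq)
    ≡⟨ degenerate pq ⟩
  + 0 ∎
  where
  open ≡-Reasoning
  p′ q′ pq : ℕ → ℤ
  p′ i = f i e
  q′ i = f i (suc e)
  pq i = p′ i + q′ i
  G : (ℕ → ℤ) → (ℕ → ℤ) → Array
  G u v = setColumn (setColumn f (suc e) v) e u
  at-e : ∀ u v i → G u v i e ≡ u i
  at-e u v = setColumn-at (setColumn f (suc e) v) e u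
  at-suc-e : ∀ u v i → G u v i (suc e) ≡ v i
  at-suc-e u v i =
    trans (setColumn-off (setColumn f (suc e) v) e u i (suc e) ℕP.1+n≢n) (setColumn-at f (suc e) v i)
  elsewhere : ∀ u v i j → j ≢ e → j ≢ suc e → G u v i j ≡ f i j
  elsewhere u v i j n1 n2 =
    trans (setColumn-off (setColumn f (suc e) v) e u i j n1) (setColumn-off f (suc e) v i j n2)
  degenerate : ∀ u → detℕ n (G u u) ≡ + 0
  degenerate u = det-adjacent-equal n (G u u) p (λ i → trans (at-e u u i) (sym (at-suc-e u u i)))
  additive-first : ∀ v → detℕ n (G pq v) ≡ detℕ n (G p′ v) + detℕ n (G q′ v)
  additive-first v = det-additive n (G p′ v) (G q′ v) (G pq v) (ℕP.<-trans (ℕP.n<1+n e) p)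
    (λ i → trans (at-e pq v i) (sym (cong₂ _+_ (at-e p′ v i) (at-e q′ v i))))
    (λ i j ne → trans (setColumn-off F e pq i j ne) (sym (setColumn-off F e p′ i j ne)))
    (λ i j ne → trans (setColumn-off F e q′ i j ne) (sym (setColumn-off F e p′ i j ne)))
    where F = setColumn f (suc e) v
  additive-second : ∀ u → detℕ n (G u pq) ≡ detℕ n (G u p′) + detℕ n (G u q′)
  additive-second u = det-additive n (G u p′) (G u q′) (G u pq) p
    (λ i → trans (at-suc-e u pq i) (sym (cong₂ _+_ (at-suc-e u p′ i) (at-suc-e u q′ i))))
    (λ i j ne → off-suc-e u pq p′ i j ne)
    (λ i j ne → trans (off-suc-e u q′ pq i j ne) (sym (off-suc-e u p′ pq i j ne)))
    where
    off-suc-e : ∀ u v v′ i j → j ≢ suc e → G u v i j ≡ G u v′ i j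
    off-suc-e u v v′ i j n2 with j ℕP.≟ e
    ... | yes refl = trans (at-e u v i) (sym (at-e u v′ i))
    ... | no n1 = trans (elsewhere u v i j n1 n2) (sym (elsewhere u v′ i j n1 n2))
  matches : ∀ {u v} h → (∀ i → h i e ≡ u i) → (∀ i → h i (suc e) ≡ v i) →
    (∀ i j → j ≢ e → j ≢ suc e → h i j ≡ f i j) → detℕ n (G u v) ≡ detℕ n h
  matches {u} {v} h h-e h-suc-e h-rest = det-cong n λ i j _ _ → entry i j
    where
    entry : ∀ i j → G u v i j ≡ h i j
    entry i j with j ℕP.≟ e | j ℕP.≟ suc e
    ... | yes refl | _      = trans (at-e u v i) (sym (h-e i))
    ... | no _     | yes refl = trans (at-suc-e u v i) (sym (h-suc-e i))
    ... | no n1    | no n2  = trans (elsewhere u v i j n1 n2) (sym (h-rest i j n1 n2))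
  rearrange : ∀ a b c d → a ≡ + 0 → d ≡ + 0 → c + b ≡ a + b + (c + d)
  rearrange _ b c _ refl refl = shuffle b c
    where shuffle : ∀ b c → c + b ≡ + 0 + b + (c + + 0)
          shuffle = solve-∀

-- Two equal columns c < e make the determinant vanish: by induction on e,
-- swapping columns e - 1 and e moves the copy of column c next to it.
det-equal-columns< : ∀ e n {c} (f : Array) → c < e → e < n → (∀ i → f i c ≡ f i e) →
  detℕ n f ≡ + 0
det-equal-columns< (suc e) n {c} f (s≤s c≤e) p eq with c ℕP.≟ e
... | yes refl = det-adjacent-equal n f p eq
... | no c≢e =
  trans (sym (ℤP.+-identityˡ _))
    (trans (cong (_+ detℕ n f) (sym swapped-vanishes))
      (det-swap-adjacent n e f swapped p (setColumn-at moved e (column (suc e))) at-suc-e elsewhere))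
  where
  column : ℕ → ℕ → ℤ
  column k i = f i k
  moved swapped : Array
  moved = setColumn f (suc e) (column e)
  swapped = setColumn moved e (column (suc e))
  c<e : c < e
  c<e = ℕP.≤∧≢⇒< c≤e c≢e
  at-suc-e : ∀ i → swapped i (suc e) ≡ f i e
  at-suc-e i = trans (setColumn-off moved e (column (suc e)) i (suc e) ℕP.1+n≢n)
                     (setColumn-at f (suc e) (column e) i)
  elsewhere : ∀ i j → j ≢ e → j ≢ suc e → swapped i j ≡ f i j
  elsewhere i j n1 n2 = trans (setColumn-off moved e (column (suc e)) i j n1)
                              (setColumn-off f (suc e) (column e) i j n2)
  swapped-vanishes : detℕ n swapped ≡ + 0
  swapped-vanishes = det-equal-columns< e n swapped c<e (ℕP.<-trans (ℕP.n<1+n e) p)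
    (λ i → trans (elsewhere i c c≢e (λ z → ℕP.<-irrefl z (ℕP.<-trans c<e (ℕP.n<1+n e))))
             (trans (eq i) (sym (setColumn-at moved e (column (suc e)) i))))

det-equal-columns : ∀ n {c e} (f : Array) → c ≢ e → c < n → e < n → (∀ i → f i c ≡ f i e) →
  detℕ n f ≡ + 0
det-equal-columns n {c} {e} f ne pc pe eq with ℕP.<-cmp c e
... | tri< c<e _ _ = det-equal-columns< e n f c<e pe eq
... | tri≈ _ c≡e _ = ⊥-elim (ne c≡e)
... | tri> _ _ e<c = det-equal-columns< c n f e<c pc (λ i → sym (eq i))

-- Adding to column c a combination of the columns, with weight 0 on column c
-- itself, does not change the determinant: add one column at a time; each
-- step adds the determinant of an array with two equal columns.
det-add-combination : ∀ n {c} (f : Array) (s : ℕ → ℤ) → c < n → s c ≡ + 0 →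
  detℕ n (setColumn f c (λ i → f i c + sum n (λ l → s l * f i l))) ≡ detℕ n f
det-add-combination n {c} f s pc sc = induct n ℕP.≤-refl
  where
  combination column scaled : ℕ → ℕ → ℤ
  combination L i = f i c + sum L (λ l → s l * f i l)
  column L i = f i L
  scaled L i = s L * f i L
  partial copy : ℕ → Array
  partial L = setColumn f c (combination L)
  copy L = setColumn f c (column L)
  agree : ∀ u v → AgreeOff c (setColumn f c u) (setColumn f c v)
  agree u v i j ne = trans (setColumn-off f c u i j ne) (sym (setColumn-off f c v i j ne))
  split-last : ∀ L i → combination (suc L) i ≡ combination L i + scaled L i
  split-last L i =
    trans (cong (λ t → f i c + t) (sum-snoc L (λ l → s l * f i l))) (sym (ℤP.+-assoc (f i c) _ _))
  step : ∀ L → detℕ n (partial (suc L)) ≡ detℕ n (partial L) + s L * detℕ n (copy L)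
  step L =
    trans (det-additive n (partial L) (setColumn f c (scaled L)) (partial (suc L)) pc
            (λ i → trans (setColumn-at f c (combination (suc L)) i)
                     (trans (split-last L i)
                       (sym (cong₂ _+_ (setColumn-at f c (combination L) i)
                                       (setColumn-at f c (scaled L) i)))))
            (agree (combination (suc L)) (combination L)) (agree (scaled L) (combination L)))
      (cong (λ t → detℕ n (partial L) + t)
        (det-scale n (s L) (copy L) _ pc
          (λ i → trans (setColumn-at f c (scaled L) i) (cong (s L *_) (sym (setColumn-at f c (column L) i))))
          (agree (scaled L) (column L))))
  copy-vanishes : ∀ L → L < n → s L * detℕ n (copy L) ≡ + 0
  copy-vanishes L pL with L ℕP.≟ c
  ... | yes refl = cong (_* detℕ n (copy L)) sc
  ... | no L≢c = trans (cong (s L *_) (det-equal-columns n (copy L) (λ e → L≢c (sym e)) pc pL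
                   (λ i → trans (setColumn-at f c (column L) i)
                            (sym (setColumn-off f c (column L) i L L≢c)))))
                   (ℤP.*-zeroʳ (s L))
  induct : ∀ L → L ≤ n → detℕ n (partial L) ≡ detℕ n f
  induct zero    _ = det-cong n λ i j _ _ → unchanged i j
    where unchanged : ∀ i j → partial 0 i j ≡ f i j
          unchanged i j with j ℕP.≟ c
          ... | yes refl = trans (setColumn-at f j (combination 0) i) (ℤP.+-identityʳ _)
          ... | no ne = setColumn-off f c (combination 0) i j ne
  induct (suc L) q = begin
    detℕ n (partial (suc L))                          ≡⟨ step L ⟩
    detℕ n (partial L) + s L * detℕ n (copy L)
      ≡⟨ cong (λ t → detℕ n (partial L) + t) (copy-vanishes L q) ⟩
    detℕ n (partial L) + + 0                          ≡⟨ ℤP.+-identityʳ _ ⟩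
    detℕ n (partial L)                                ≡⟨ induct L (ℕP.<⇒≤ q) ⟩
    detℕ n f ∎
    where open ≡-Reasoning

eliminate : ℕ → (ℕ → Bool) → (ℕ → ℕ → ℤ) → Array → Array
eliminate n Q coef f i j = if Q j then f i j + sum n (λ l → coef j l * f i l) else f i j

-- If the combination added to a selected column K never involves a selected
-- column l ≤ K, the elimination is a sequence of `det-add-combination`
-- steps, taken from left to right, so it preserves the determinant.
det-eliminate : ∀ n (Q : ℕ → Bool) (coef : ℕ → ℕ → ℤ) (f : Array) →
  (∀ K l → Q K ≡ true → Q l ≡ true → l ≤ K → coef K l ≡ + 0) →
  detℕ n (eliminate n Q coef f) ≡ detℕ n f
det-eliminate n Q coef f earlier-untouched = trans (det-cong n all-done) (induct n ℕP.≤-refl)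
  where
  below : ℕ → ℕ → Bool
  below K j = (j <ᵇ K) ∧ Q j
  partial : ℕ → Array
  partial K = eliminate n (below K) coef f
  all-done : ∀ i j → i < n → j < n → eliminate n Q coef f i j ≡ partial n i j
  all-done i j _ pj rewrite <ᵇ-true pj = refl
  combination-sees-f : ∀ K → Q K ≡ true → ∀ i l → coef K l * partial K i l ≡ coef K l * f i l
  combination-sees-f K QK i l with l <ᵇ K in l<K | Q l in Ql
  ... | true  | true  rewrite earlier-untouched K l QK Ql (ℕP.<⇒≤ (<ᵇ-sound l<K)) = refl
  ... | true  | false = refl
  ... | false | _     = refl
  induct : ∀ K → K ≤ n → detℕ n (partial K) ≡ detℕ n f
  induct zero    _ = refl
  induct (suc K) q with Q K in QK
  ... | false = trans (det-cong n (λ i j _ _ → same i j)) (induct K (ℕP.<⇒≤ q))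
    where
    same : ∀ i j → partial (suc K) i j ≡ partial K i j
    same i j with j ℕP.≟ K
    ... | yes refl rewrite <ᵇ-self j | <ᵇ-suc-self j | QK = refl
    ... | no ne rewrite <ᵇ-suc j K ne = refl
  ... | true = trans (det-cong n (λ i j _ _ → one-more i j))
                 (trans (det-add-combination n (partial K) (coef K) q
                          (earlier-untouched K K QK QK ℕP.≤-refl))
                   (induct K (ℕP.<⇒≤ q)))
    where
    one-more : ∀ i j → partial (suc K) i j ≡
      setColumn (partial K) K (λ i → partial K i K + sum n (λ l → coef K l * partial K i l)) i j
    one-more i j with j ℕP.≟ K
    ... | yes refl rewrite ≡ᵇ-true {j} refl | <ᵇ-self j | <ᵇ-suc-self j | QK =
          cong (λ t → f i j + t) (sum-cong n (λ l _ → sym (combination-sees-f j QK i l)))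
    ... | no ne rewrite <ᵇ-suc j K ne | ≡ᵇ-false ne = refl

det-scale-columns : ∀ n (σ : ℕ → ℤ) (g : Array) →
  detℕ n (λ i j → σ j * g i j) ≡ prod n σ * detℕ n g
det-scale-columns n σ g = trans (det-cong n all-done) (induct n ℕP.≤-refl)
  where
  partial : ℕ → Array
  partial K i j = if j <ᵇ K then σ j * g i j else g i j
  all-done : ∀ i j → i < n → j < n → σ j * g i j ≡ partial n i j
  all-done i j _ pj rewrite <ᵇ-true pj = refl
  at-K : ∀ K i → partial (suc K) i K ≡ σ K * partial K i K
  at-K K i rewrite <ᵇ-self K | <ᵇ-suc-self K = refl
  off-K : ∀ K → AgreeOff K (partial (suc K)) (partial K)
  off-K K i j ne rewrite <ᵇ-suc j K ne = refl
  induct : ∀ K → K ≤ n → detℕ n (partial K) ≡ prod K σ * detℕ n g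
  induct zero    _ = sym (ℤP.*-identityˡ _)
  induct (suc K) q = begin
    detℕ n (partial (suc K))          ≡⟨ det-scale n (σ K) (partial K) _ q (at-K K) (off-K K) ⟩
    σ K * detℕ n (partial K)          ≡⟨ cong (σ K *_) (induct K (ℕP.<⇒≤ q)) ⟩
    σ K * (prod K σ * detℕ n g)       ≡⟨ sym (ℤP.*-assoc (σ K) (prod K σ) _) ⟩
    σ K * prod K σ * detℕ n g
      ≡⟨ cong (_* detℕ n g) (trans (ℤP.*-comm (σ K) (prod K σ)) (sym (prod-snoc K σ))) ⟩
    prod (suc K) σ * detℕ n g ∎
    where open ≡-Reasoning

-- All column
-- operations of the main proof end in an array whose columns 1, …, K are path
-- columns; its determinant is computed by expanding along row 0, where only
-- the two outer columns contribute.

pathColumn backColumn : ℕ → ℕ → ℤ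
pathColumn j i = δ i j - δ i (suc j)
backColumn b a = δ (suc a) b - δ a b

sum-ends : ∀ K (t : ℕ → ℤ) → (∀ j → j < K → t (suc j) ≡ + 0) →
  sum (suc (suc K)) t ≡ t 0 + t (suc K)
sum-ends K t z = cong (λ w → t 0 + w)
  (trans (sum-snoc K (λ j → t (suc j))) (trans (cong (_+ t (suc K)) (sum-zero K z)) (ℤP.+-identityˡ _)))

term-zero : ∀ n f j → f 0 j ≡ + 0 → term n f j ≡ + 0
term-zero n f j z = trans (cong (λ u → sign j * u * detℕ n (minorℕ f j)) z)
                      (cong (_* detℕ n (minorℕ f j)) (ℤP.*-zeroʳ (sign j)))

-- All columns backward: the matrix is −1 on the diagonal and 1 just above it.
det-backward : ∀ K (f : Array) → (∀ a b → b < K → f a b ≡ backColumn b a) → detℕ K f ≡ sign K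
det-backward zero    f h = refl
det-backward (suc K) f h =
  trans (cong₂ _+_ first (sum-zero K rest)) (trans (ℤP.+-identityʳ _) (sym (sign-suc K)))
  where
  minus : ∀ s → + 1 * (+ 0 - + 1) * s ≡ - s
  minus = solve-∀
  first : term K f 0 ≡ - sign K
  first = trans (cong₂ (λ u v → sign 0 * u * v) (h 0 0 (s≤s z≤n))
                  (det-backward K (minorℕ f 0) (λ a b p → h (suc a) (suc b) (s≤s p))))
            (minus (sign K))
  rest : ∀ j → j < K → term K f (suc j) ≡ + 0
  rest zero    p = trans (cong (sign 1 * f 0 1 *_)
                           (det-zero-column K (minorℕ f 1) p (λ a → h (suc a) 0 (s≤s z≤n))))
                     (ℤP.*-zeroʳ (sign 1 * f 0 1))
  rest (suc j) p = term-zero K f (suc (suc j)) (h 0 (suc (suc j)) (s≤s p))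

det-backward-after : ∀ K (f : Array) → (∀ a b → 1 ≤ b → b < suc K → f a b ≡ backColumn b a) →
  detℕ (suc K) f ≡ sign K * sum (suc K) (λ a → f a 0)
det-backward-after zero    f h = edge (f 0 0)
  where edge : ∀ x → + 1 * x * + 1 + + 0 ≡ + 1 * (x + + 0)
        edge = solve-∀
det-backward-after (suc K) f h = begin
  term (suc K) f 0 + (term (suc K) f 1 + sum K (λ j → term (suc K) f (suc (suc j))))
    ≡⟨ cong (λ z → term (suc K) f 0 + (term (suc K) f 1 + z)) (sum-zero K rest) ⟩
  term (suc K) f 0 + (term (suc K) f 1 + + 0)
    ≡⟨ cong₂ (λ u v → u + (v + + 0)) first second ⟩
  f 0 0 * sign (suc K) + (- (sign K * sum (suc K) (λ a → f (suc a) 0)) + + 0)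
    ≡⟨ cong (λ s → f 0 0 * s + (- (sign K * sum (suc K) (λ a → f (suc a) 0)) + + 0)) (sign-suc K) ⟩
  f 0 0 * - sign K + (- (sign K * sum (suc K) (λ a → f (suc a) 0)) + + 0)
    ≡⟨ collect (sign K) (f 0 0) _ ⟩
  - sign K * (f 0 0 + sum (suc K) (λ a → f (suc a) 0))
    ≡⟨ cong (_* (f 0 0 + sum (suc K) (λ a → f (suc a) 0))) (sym (sign-suc K)) ⟩
  sign (suc K) * sum (suc (suc K)) (λ a → f a 0) ∎
  where
  open ≡-Reasoning
  collect : ∀ s x y → x * (- s) + (- (s * y) + + 0) ≡ (- s) * (x + y)
  collect = solve-∀
  first : term (suc K) f 0 ≡ f 0 0 * sign (suc K)
  first = trans (cong (sign 0 * f 0 0 *_)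
                  (det-backward (suc K) (minorℕ f 0)
                     (λ a b p → h (suc a) (suc b) (s≤s z≤n) (s≤s p))))
            (cong (_* sign (suc K)) (ℤP.*-identityˡ (f 0 0)))
  second : term (suc K) f 1 ≡ - (sign K * sum (suc K) (λ a → f (suc a) 0))
  second = trans (cong₂ (λ u v → sign 1 * u * v) (h 0 1 (s≤s z≤n) (s≤s (s≤s z≤n)))
                   (det-backward-after K (minorℕ f 1) shifted))
             (negate _)
    where
    shifted : ∀ a b → 1 ≤ b → b < suc K → minorℕ f 1 a b ≡ backColumn b a
    shifted a (suc b) _ (s≤s p) = h (suc a) (suc (suc b)) (s≤s z≤n) (s≤s (s≤s p))
    negate : ∀ z → - (+ 1) * (+ 1 - + 0) * z ≡ - z
    negate = solve-∀
  rest : ∀ j → j < K → term (suc K) f (suc (suc j)) ≡ + 0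
  rest j p = term-zero (suc K) f (suc (suc j)) (h 0 (suc (suc j)) (s≤s z≤n) (s≤s (s≤s p)))

det-path-before : ∀ K (f : Array) → (∀ i j → j < K → f i j ≡ pathColumn j i) →
  detℕ (suc K) f ≡ sum (suc K) (λ i → f i K)
det-path-before zero    f h = edge (f 0 0)
  where edge : ∀ x → + 1 * x * + 1 + + 0 ≡ x + + 0
        edge = solve-∀
det-path-before (suc K) f h =
  trans (sum-ends K (term (suc K) f) middle) (trans (cong₂ _+_ first last) (ℤP.+-comm _ (f 0 (suc K))))
  where
  middle : ∀ j → j < K → term (suc K) f (suc j) ≡ + 0
  middle j p = term-zero (suc K) f (suc j) (h 0 (suc j) (s≤s p))
  first : term (suc K) f 0 ≡ sum (suc K) (λ a → f (suc a) (suc K))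
  first = trans (cong₂ (λ u v → sign 0 * u * v) (h 0 0 (s≤s z≤n))
                  (det-path-before K (minorℕ f 0) (λ a b p → h (suc a) (suc b) (s≤s p))))
            (unit _)
    where unit : ∀ z → + 1 * (+ 1 - + 0) * z ≡ z
          unit = solve-∀
  backward : ∀ a b → 1 ≤ b → b < suc K → minorℕ f (suc K) a b ≡ backColumn b a
  backward a b _ p rewrite punchIn-below (suc K) b p = h (suc a) b p
  column0 : ∀ a → a < suc K → minorℕ f (suc K) a 0 ≡ - δ a 0
  column0 a p = trans (h (suc a) 0 (s≤s z≤n)) (zero-minus (δ a 0))
    where zero-minus : ∀ z → + 0 - z ≡ - z
          zero-minus = solve-∀
  last : term (suc K) f (suc K) ≡ f 0 (suc K)
  last = begin
    sign (suc K) * f 0 (suc K) * detℕ (suc K) (minorℕ f (suc K))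
      ≡⟨ cong₂ (λ s v → s * f 0 (suc K) * v) (sign-suc K)
           (det-backward-after K (minorℕ f (suc K)) backward) ⟩
    - sign K * f 0 (suc K) * (sign K * sum (suc K) (λ a → minorℕ f (suc K) a 0))
      ≡⟨ cong (λ z → - sign K * f 0 (suc K) * (sign K * z))
           (trans (sum-cong (suc K) column0) (trans (sum-neg (suc K) (λ a → δ a 0))
             (cong -_ (sum-single (suc K) 0 _ (s≤s z≤n) (λ j _ ne → δ-other ne))))) ⟩
    - sign K * f 0 (suc K) * (sign K * - (+ 1))
      ≡⟨ square (sign K) (f 0 (suc K)) ⟩
    sign K * sign K * f 0 (suc K)
      ≡⟨ trans (cong (_* f 0 (suc K)) (sign-square K)) (ℤP.*-identityˡ _) ⟩
    f 0 (suc K) ∎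
    where
    open ≡-Reasoning
    square : ∀ s x → - s * x * (s * - (+ 1)) ≡ s * s * x
    square = solve-∀

det-path-interior : ∀ K (f : Array) → (∀ i j → 1 ≤ j → j ≤ K → f i j ≡ pathColumn j i) →
  detℕ (suc (suc K)) f
    ≡ f 0 0 * sum (suc K) (λ i → f (suc i) (suc K)) - f 0 (suc K) * sum (suc K) (λ i → f (suc i) 0)
det-path-interior K f h = trans (sum-ends K (term (suc K) f) middle) (cong₂ _+_ first last)
  where
  middle : ∀ j → j < K → term (suc K) f (suc j) ≡ + 0
  middle j p = term-zero (suc K) f (suc j) (h 0 (suc j) (s≤s z≤n) p)
  first : term (suc K) f 0 ≡ f 0 0 * sum (suc K) (λ i → f (suc i) (suc K))
  first = trans (cong (sign 0 * f 0 0 *_)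
                  (det-path-before K (minorℕ f 0) (λ a b p → h (suc a) (suc b) (s≤s z≤n) p)))
            (cong (_* sum (suc K) (λ i → f (suc i) (suc K))) (ℤP.*-identityˡ (f 0 0)))
  backward : ∀ a b → 1 ≤ b → b < suc K → minorℕ f (suc K) a b ≡ backColumn b a
  backward a b q p rewrite punchIn-below (suc K) b p = h (suc a) b q (ℕP.≤-pred p)
  last : term (suc K) f (suc K) ≡ - (f 0 (suc K) * sum (suc K) (λ i → f (suc i) 0))
  last = trans (cong₂ (λ s v → s * f 0 (suc K) * v) (sign-suc K)
                  (det-backward-after K (minorℕ f (suc K)) backward))
           (trans (cong (λ z → - sign K * f 0 (suc K) * (sign K * z))
                     (sum-cong (suc K) (λ a p → cong (f (suc a)) (punchIn-below (suc K) 0 (s≤s z≤n)))))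
             (square (sign K) (f 0 (suc K)) _ (sign-square K)))
    where
    square : ∀ s x y → s * s ≡ + 1 → - s * x * (s * y) ≡ - (x * y)
    square s x y e =
      trans (regroup s x y) (trans (cong (λ z → - (z * (x * y))) e) (cong -_ (ℤP.*-identityˡ _)))
      where regroup : ∀ s x y → - s * x * (s * y) ≡ - ((s * s) * (x * y))
            regroup = solve-∀

previous : (ℕ → ℤ) → ℕ → ℤ
previous w zero    = + 0
previous w (suc i) = w i

telescope : ∀ n (w : ℕ → ℤ) i → i < n → sum n (λ l → w l * pathColumn l i) ≡ w i - previous w i
telescope n w i p = begin
  sum n (λ l → w l * pathColumn l i)
    ≡⟨ sum-cong n (λ l _ → ℤP.*-distribˡ-+ (w l) (δ i l) (- δ i (suc l))) ⟩
  sum n (λ l → w l * δ i l + w l * - δ i (suc l))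
    ≡⟨ sum-+ n (λ l → w l * δ i l) (λ l → w l * - δ i (suc l)) ⟩
  sum n (λ l → w l * δ i l) + sum n (λ l → w l * - δ i (suc l))
    ≡⟨ cong₂ _+_ (pick i p)
         (trans (sum-cong n (λ l _ → sym (ℤP.neg-distribʳ-* (w l) (δ i (suc l)))))
           (trans (sum-neg n (λ l → w l * δ i (suc l))) (cong -_ (pick-previous i p)))) ⟩
  w i - previous w i ∎
  where
  open ≡-Reasoning
  pick : ∀ i → i < n → sum n (λ l → w l * δ i l) ≡ w i
  pick i p = trans (sum-cong n (λ l _ → trans (ℤP.*-comm (w l) (δ i l)) (cong (_* w l) (δ-sym i l))))
                   (sum-δ n i w p)
  pick-previous : ∀ i → i < n → sum n (λ l → w l * δ i (suc l)) ≡ previous w i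
  pick-previous zero    _ = sum-zero n (λ l _ → ℤP.*-zeroʳ (w l))
  pick-previous (suc i) q = pick i (ℕP.<-trans (ℕP.n<1+n i) q)

indicator : ℕ → ℕ → ℕ → ℤ
indicator s e u = if u <ᵇ s then + 0 else (if u <ᵇ e then + 1 else + 0)

ramp : ℕ → ℕ → ℕ → ℤ
ramp s L u = if u <ᵇ s then + 0 else (if u <ᵇ s ℕ.+ L then + suc (u ∸ s) else + 0)

indicator-outside : ∀ s e u → s ≤ e → u < s ⊎ e ≤ u → indicator s e u ≡ + 0
indicator-outside s e u _   (inj₁ p) rewrite <ᵇ-true p = refl
indicator-outside s e u s≤e (inj₂ p) rewrite <ᵇ-false (ℕP.≤-trans s≤e p) | <ᵇ-false p = refl

ramp-outside : ∀ s L u → u < s ⊎ s ℕ.+ L ≤ u → ramp s L u ≡ + 0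
ramp-outside s L u (inj₁ p) rewrite <ᵇ-true p = refl
ramp-outside s L u (inj₂ p) rewrite <ᵇ-false (ℕP.≤-trans (ℕP.m≤m+n s L) p) | <ᵇ-false p = refl

previous-indicator-shift : ∀ s e u →
  previous (indicator (suc s) (suc e)) (suc u) ≡ previous (indicator s e) u
previous-indicator-shift s e zero    = refl
previous-indicator-shift s e (suc u) = refl

previous-ramp-shift : ∀ s L u → previous (ramp (suc s) L) (suc u) ≡ previous (ramp s L) u
previous-ramp-shift s L zero    = refl
previous-ramp-shift s L (suc u) = refl

indicator-step : ∀ s e u → s ≤ e → indicator s e u - previous (indicator s e) u ≡ δ u s - δ u e
indicator-step (suc s) (suc e) zero    _       = refl
indicator-step (suc s) (suc e) (suc u) (s≤s p) =
  trans (cong (λ t → indicator s e u - t) (previous-indicator-shift s e u)) (indicator-step s e u p)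
indicator-step zero    zero    zero    _ = refl
indicator-step zero    (suc e) zero    _ = refl
indicator-step zero    e       (suc u) _ with ℕP.<-cmp (suc u) e
... | tri< lt _ _ rewrite <ᵇ-true lt | <ᵇ-true (ℕP.<-trans (ℕP.n<1+n u) lt) | ≡ᵇ-false (ℕP.<⇒≢ lt)
  = refl
... | tri≈ _ refl _ rewrite <ᵇ-self (suc u) | <ᵇ-suc-self u | ≡ᵇ-true {u} refl = refl
... | tri> _ ne gt rewrite <ᵇ-false (ℕP.<⇒≤ gt) | <ᵇ-false (ℕP.≤-pred gt) | ≡ᵇ-false ne = refl

ramp-step : ∀ s L u →
  ramp s L u - previous (ramp s L) u ≡ indicator s (s ℕ.+ suc L) u - + suc L * δ u (s ℕ.+ L)
ramp-step (suc s) L zero    = sym (cong (λ t → + 0 - t) (ℤP.*-zeroʳ (+ suc L)))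
ramp-step (suc s) L (suc u) =
  trans (cong (λ t → ramp s L u - t) (previous-ramp-shift s L u)) (ramp-step s L u)
ramp-step zero    zero    zero = refl
ramp-step zero    (suc L) zero = sym (cong (λ t → + 1 - t) (ℤP.*-zeroʳ (+ suc (suc L))))
ramp-step zero    L       (suc u) with ℕP.<-cmp (suc u) L
... | tri< lt _ _ rewrite <ᵇ-true lt | <ᵇ-true (ℕP.<-trans (ℕP.n<1+n u) lt) | ≡ᵇ-false (ℕP.<⇒≢ lt)
  = trans (rise (+ suc u)) (sym (cong (λ t → + 1 - t) (ℤP.*-zeroʳ (+ suc L))))
  where rise : ∀ y → (+ 1 + y) - y ≡ + 1
        rise = solve-∀
... | tri≈ _ refl _ rewrite <ᵇ-self (suc u) | <ᵇ-suc-self u | ≡ᵇ-true {u} refl = drop (+ u)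
  where drop : ∀ y → + 0 - (+ 1 + y) ≡ + 1 - (+ 1 + (+ 1 + y)) * + 1
        drop = solve-∀
... | tri> _ ne gt rewrite <ᵇ-false (ℕP.<⇒≤ gt) | <ᵇ-false (ℕP.≤-pred gt) | ≡ᵇ-false ne
  = sym (cong (λ t → + 0 - t) (ℤP.*-zeroʳ (+ suc L)))

countBelow : ℕ → (ℕ → Bool) → ℕ
countBelow zero    q = 0
countBelow (suc r) q =
  if q 0 then suc (countBelow r (λ t → q (suc t))) else countBelow r (λ t → q (suc t))

count-tabulate : ∀ {n r} (p : (Fin n → Bool) → Bool) (e : Fin r → Fin n → Bool) (q : ℕ → Bool) →
  (∀ t → p (e t) ≡ q (toℕ t)) → count p (tabulate e) ≡ countBelow r q
count-tabulate {r = zero}  p e q h = refl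
count-tabulate {r = suc r} p e q h
  rewrite h F.zero | count-tabulate p (λ t → e (F.suc t)) (λ t → q (suc t)) (λ t → h (F.suc t)) = refl

countBelow-none : ∀ r → countBelow r (λ _ → false) ≡ 0
countBelow-none zero    = refl
countBelow-none (suc r) = countBelow-none r

countBelow-unique : ∀ r A (b : ℕ → Bool) → A < r →
  countBelow r (λ t → (t ≡ᵇ A) ∧ b t) ≡ (if b A then 1 else 0)
countBelow-unique (suc r) zero    b _ with b 0
... | true  = cong suc (countBelow-none r)
... | false = countBelow-none r
countBelow-unique (suc r) (suc A) b (s≤s p) = countBelow-unique r A (λ t → b (suc t)) p

Fin-≟-toℕ : ∀ {n} (u v : Fin n) → ⌊ u F.≟ v ⌋ ≡ (toℕ u ≡ᵇ toℕ v)
Fin-≟-toℕ u v with u F.≟ v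
... | yes refl = sym (≡ᵇ-true {toℕ u} refl)
... | no ne    = sym (≡ᵇ-false (λ e → ne (FP.toℕ-injective e)))

-- Matrix
-- index 0 is the centre; index suc v is spoke vertex v, which lies on spoke
-- v / m.  The columns 1, …, N are grouped by spoke; column j ≥ 1 is the tip
-- (outermost vertex) of its spoke when m ∣ j.
module Star (m′ r′ : ℕ) (x : ℤ) where

  m r k N n : ℕ
  m = suc m′
  r = suc r′
  k = suc m
  N = m ℕ.* r
  n = suc N

  -- x − k and x − 1: the factors contributed by the inner vertices and by
  -- all spokes but one.
  a c : ℤ
  a = x - + k
  c = x - + 1

  c≡a+m : c ≡ a + + m
  c≡a+m = shift x (+ m)
    where shift : ∀ x y → x - + 1 ≡ (x - (+ 1 + y)) + y
          shift = solve-∀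

  divmod : ∀ v → v ≡ v % m ℕ.+ (v / m) ℕ.* m
  divmod v = m≡m%n+[m/n]*n v m

  div-unique : ∀ q T → q < m → (q ℕ.+ T ℕ.* m) / m ≡ T
  div-unique q T p = trans (+-distrib-/-∣ʳ q (n∣m*n T)) (cong₂ ℕ._+_ (m<n⇒m/n≡0 p) (m*n/n≡m T m))

  mod-unique : ∀ q T → q < m → (q ℕ.+ T ℕ.* m) % m ≡ q
  mod-unique q T p = trans ([m+kn]%n≡m%n q T m) (m<n⇒m%n≡m p)

  small-residue : ∀ j → j < m → j % m ≡ j
  small-residue j p = m<n⇒m%n≡m p

  residue-shift : ∀ j → (j ℕ.+ m) % m ≡ j % m
  residue-shift j = [m+n]%n≡m%n j m

  below-spoke : ∀ {t v} → v / m < t → v < t ℕ.* m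
  below-spoke {t} {v} lt =
    ℕP.≰⇒> λ tm≤v → ℕP.<⇒≱ lt (subst (_≤ v / m) (m*n/n≡m t m) (/-monoˡ-≤ m tm≤v))

  above-spoke : ∀ {t v} → t < v / m → suc t ℕ.* m ≤ v
  above-spoke lt = ℕP.≮⇒≥ λ v< → ℕP.<⇒≱ (m<n*o⇒m/o<n v<) lt

  within-spoke : ∀ v → v < suc (v / m) ℕ.* m
  within-spoke v =
    subst (_< m ℕ.+ (v / m) ℕ.* m) (sym (divmod v)) (ℕP.+-monoˡ-< ((v / m) ℕ.* m) (m%n<n v m))

  spoke-< : ∀ v → v < N → v / m < r
  spoke-< v p = m<n*o⇒m/o<n (subst (v <_) (ℕP.*-comm m r) p)

  next-spoke : ∀ j → (m ℕ.+ j) / m ≡ suc (j / m)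
  next-spoke j = trans (m/n≡1+[m∸n]/n (ℕP.m≤m+n m j)) (cong (λ z → suc (z / m)) (ℕP.m+n∸m≡n m j))

  in-spoke : ∀ t v → ((t ℕ.* m ≤ᵇ v) ∧ (v <ᵇ suc t ℕ.* m)) ≡ (t ≡ᵇ v / m)
  in-spoke t v with ℕP.<-cmp t (v / m)
  ... | tri≈ _ refl _ rewrite ≡ᵇ-true {t} refl =
    cong₂ _∧_ (≤ᵇ-true (m/n*n≤m v m)) (<ᵇ-true (within-spoke v))
  ... | tri< lt ne _  rewrite ≡ᵇ-false ne =
    trans (cong ((t ℕ.* m ≤ᵇ v) ∧_) (<ᵇ-false (above-spoke {t} {v} lt))) (∧-zeroʳ _)
  ... | tri> _ ne gt  rewrite ≡ᵇ-false ne =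
    cong (_∧ (v <ᵇ suc t ℕ.* m)) (≤ᵇ-false (below-spoke {t} {v} gt))

  onSpoke : ℕ → ℕ → ℤ
  onSpoke t v = if t ≡ᵇ v / m then + 1 else + 0

  sameSpoke : ℕ → ℕ → ℤ
  sameSpoke u = onSpoke (u / m)

  spoke-size′ : ∀ R T → T < R → sum (R ℕ.* m) (onSpoke T) ≡ + m
  spoke-size′ (suc R) T p = trans (sum-split m (R ℕ.* m) (onSpoke T)) (by-spoke T p)
    where
    first-spoke : ∀ t v → v < m → onSpoke t v ≡ (if t ≡ᵇ 0 then + 1 else + 0)
    first-spoke t v q = cong (λ z → if t ≡ᵇ z then + 1 else + 0) (m<n⇒m/n≡0 q)
    later-spoke : ∀ t j → onSpoke t (m ℕ.+ j) ≡ (if t ≡ᵇ suc (j / m) then + 1 else + 0)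
    later-spoke t j = cong (λ z → if t ≡ᵇ z then + 1 else + 0) (next-spoke j)
    by-spoke : ∀ T → T < suc R → sum m (onSpoke T) + sum (R ℕ.* m) (λ j → onSpoke T (m ℕ.+ j)) ≡ + m
    by-spoke zero    _     =
      trans (cong₂ _+_ (trans (sum-cong m (λ v q → first-spoke 0 v q)) (sum-ones m))
                       (sum-zero (R ℕ.* m) (λ j _ → later-spoke 0 j)))
            (ℤP.+-identityʳ _)
    by-spoke (suc T) (s≤s q) =
      trans (cong₂ _+_ (sum-zero m (λ v q → first-spoke (suc T) v q))
                       (trans (sum-cong (R ℕ.* m) (λ j _ → later-spoke (suc T) j)) (spoke-size′ R T q)))
            (ℤP.+-identityˡ _)

  spoke-size : ∀ u → u < N → sum N (sameSpoke u) ≡ + m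
  spoke-size u p =
    subst (λ z → sum z (sameSpoke u) ≡ + m) (ℕP.*-comm r m) (spoke-size′ r (u / m) (spoke-< u p))

  H : Hypergraph n
  H = star k r

  adjℕ : ℕ → ℕ → ℤ
  adjℕ zero    zero    = + 0
  adjℕ zero    (suc v) = + 1
  adjℕ (suc u) zero    = + 1
  adjℕ (suc u) (suc v) = if u ≡ᵇ v then + 0 else sameSpoke u v

  edges-through : ∀ (p : (Fin n → Bool) → Bool) (q : ℕ → Bool) →
    (∀ t → p (starEdge k r t) ≡ q (toℕ t)) → count p (edges H) ≡ countBelow r q
  edges-through p q h =
    trans (cong (count p) (map-tabulate (λ t → t) (starEdge k r))) (count-tabulate p (starEdge k r) q h)

  spoke-edge : ∀ (t : Fin r) (v : Fin N) → starEdge k r t (F.suc v) ≡ (toℕ t ≡ᵇ toℕ v / m)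
  spoke-edge t v = in-spoke (toℕ t) (toℕ v)

  one-edge : ∀ (v : Fin N) → countBelow r (λ t → (t ≡ᵇ toℕ v / m) ∧ true) ≡ 1
  one-edge v = countBelow-unique r _ (λ _ → true) (spoke-< (toℕ v) (FP.toℕ<n v))

  +-if : ∀ b → + (if b then 1 else 0) ≡ (if b then + 1 else + 0)
  +-if true  = refl
  +-if false = refl

  adjacency-star : ∀ i j → adjacency H i j ≡ adjℕ (toℕ i) (toℕ j)
  adjacency-star F.zero    F.zero    = refl
  adjacency-star F.zero    (F.suc v) = cong +_ (trans
    (edges-through _ (λ t → (t ≡ᵇ toℕ v / m) ∧ true) (λ t → trans (spoke-edge t v) (sym (∧-identityʳ _))))
    (one-edge v))
  adjacency-star (F.suc u) F.zero    = cong +_ (trans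
    (edges-through _ (λ t → (t ≡ᵇ toℕ u / m) ∧ true) (λ t → cong (_∧ true) (spoke-edge t u)))
    (one-edge u))
  adjacency-star (F.suc u) (F.suc v) rewrite Fin-≟-toℕ (F.suc u) (F.suc v) =
    cong (if toℕ u ≡ᵇ toℕ v then + 0 else_) (trans (cong +_ edge-count) (+-if _))
    where
    edge-count : count (λ e → e (F.suc u) ∧ e (F.suc v)) (edges H)
                   ≡ (if toℕ u / m ≡ᵇ toℕ v / m then 1 else 0)
    edge-count =
      trans (edges-through _ (λ t → (t ≡ᵇ toℕ u / m) ∧ (t ≡ᵇ toℕ v / m))
                           (λ t → cong₂ _∧_ (spoke-edge t u) (spoke-edge t v)))
            (countBelow-unique r _ (λ t → t ≡ᵇ toℕ v / m) (spoke-< (toℕ u) (FP.toℕ<n u)))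

  degree-centre : lapDegree H F.zero ≡ + N
  degree-centre = trans (∑≡sum n (adjℕ 0) (adjacency-star F.zero)) (trans (ℤP.+-identityˡ _) (sum-ones N))

  degree-spoke : ∀ (u : Fin N) → lapDegree H (F.suc u) ≡ + m
  degree-spoke u = begin
    lapDegree H (F.suc u)
      ≡⟨ ∑≡sum n (adjℕ (suc U)) (adjacency-star (F.suc u)) ⟩
    + 1 + sum N row
      ≡⟨ ℤP.+-comm (+ 1) (sum N row) ⟩
    sum N row + + 1
      ≡⟨ cong (λ t → sum N row + t) (sym (sum-δ N U (λ _ → + 1) U<N)) ⟩
    sum N row + sum N (λ v → δ v U * + 1)
      ≡⟨ sym (sum-+ N row (λ v → δ v U * + 1)) ⟩
    sum N (λ v → row v + δ v U * + 1)
      ≡⟨ sum-cong N (λ v _ → restore v) ⟩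
    sum N (sameSpoke U)
      ≡⟨ spoke-size U U<N ⟩
    + m ∎
    where
    open ≡-Reasoning
    U = toℕ u
    U<N = FP.toℕ<n u
    row : ℕ → ℤ
    row v = adjℕ (suc U) (suc v)
    restore : ∀ v → row v + δ v U * + 1 ≡ sameSpoke U v
    restore v with v ℕP.≟ U
    ... | yes refl rewrite ≡ᵇ-true {v} refl | ≡ᵇ-true {v / m} refl = refl
    ... | no ne    rewrite ≡ᵇ-false (λ e → ne (sym e)) | ≡ᵇ-false ne = ℤP.+-identityʳ _

  charMatrix : Array
  charMatrix zero    zero    = x - + N
  charMatrix zero    (suc v) = + 1
  charMatrix (suc u) zero    = + 1
  charMatrix (suc u) (suc v) = a * δ u v + sameSpoke u v

  charMatrix-entries : ∀ i j →
    (if ⌊ i F.≟ j ⌋ then x else + 0) - laplacian H i j ≡ charMatrix (toℕ i) (toℕ j)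
  charMatrix-entries F.zero    F.zero    =
    trans (cong (λ d → x - (d - + 0)) degree-centre) (cong (λ t → x - t) (ℤP.+-identityʳ (+ N)))
  charMatrix-entries F.zero    (F.suc v) = cong (λ z → + 0 - (+ 0 - z)) (adjacency-star F.zero (F.suc v))
  charMatrix-entries (F.suc u) F.zero    = cong (λ z → + 0 - (+ 0 - z)) (adjacency-star (F.suc u) F.zero)
  charMatrix-entries (F.suc u) (F.suc v) =
    trans (cong₂ (λ b z → (if b then x else + 0) - ((if b then lapDegree H (F.suc u) else + 0) - z))
             (Fin-≟-toℕ (F.suc u) (F.suc v)) (adjacency-star (F.suc u) (F.suc v)))
      (diagonal-or-not (toℕ u) (toℕ v) (degree-spoke u))
    where
    diagonal-or-not : ∀ U V {D} → D ≡ + m →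
      (if U ≡ᵇ V then x else + 0) - ((if U ≡ᵇ V then D else + 0) - (if U ≡ᵇ V then + 0 else sameSpoke U V))
        ≡ a * δ U V + sameSpoke U V
    diagonal-or-not U V refl with U ℕP.≟ V
    ... | yes refl rewrite ≡ᵇ-true {U} refl | ≡ᵇ-true {U / m} refl = on-diagonal x (+ m)
      where on-diagonal : ∀ x y → x - (y - + 0) ≡ (x - (+ 1 + y)) * + 1 + + 1
            on-diagonal = solve-∀
    ... | no ne rewrite ≡ᵇ-false ne =
      trans (off-diagonal (sameSpoke U V)) (cong (_+ sameSpoke U V) (sym (ℤP.*-zeroʳ a)))
      where off-diagonal : ∀ y → + 0 - (+ 0 - y) ≡ + 0 + y
            off-diagonal = solve-∀

  charPoly≡detℕ : charPoly (laplacian H) x ≡ detℕ n charMatrix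
  charPoly≡detℕ = det≡detℕ n _ charMatrix charMatrix-entries

  -- Column types.  Inner columns are spoke vertices other than tips; early
  -- tips are the tips of all spokes but the final one, whose tip is column N.

  isInner isTip isEarlyTip : ℕ → Bool
  isInner j    = (j <ᵇ N) ∧ not (j % m ≡ᵇ 0)
  isTip j      = not (j ≡ᵇ 0) ∧ (j % m ≡ᵇ 0)
  isEarlyTip j = (j <ᵇ N) ∧ isTip j

  inner-info : ∀ j → isInner j ≡ true → j < N × j % m ≢ 0
  inner-info j e with j <ᵇ N in below | j % m ≡ᵇ 0 in tip
  inner-info j e  | true  | false = <ᵇ-sound below , λ z → true≢false (trans (sym (≡ᵇ-true z)) tip)
  inner-info j () | true  | true
  inner-info j () | false | _

  tip-divides : ∀ w → isTip (suc w) ≡ true → suc w % m ≡ 0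
  tip-divides w e = ≡ᵇ-sound e

  tip-not-inner : ∀ j → isTip j ≡ true → isInner j ≡ false
  tip-not-inner j e with j % m ≡ᵇ 0 in tip
  tip-not-inner j e       | true  = ∧-zeroʳ (j <ᵇ N)
  tip-not-inner zero    () | false
  tip-not-inner (suc w) () | false

  earlyTip-info : ∀ j → isEarlyTip j ≡ true → j < N × isTip j ≡ true
  earlyTip-info j e with j <ᵇ N in below | isTip j
  earlyTip-info j e  | true  | true  = <ᵇ-sound below , refl
  earlyTip-info j () | true  | false
  earlyTip-info j () | false | _

  spokeOf : ℕ → ℕ
  spokeOf j = j / m ∸ 1

  tip-shape : ∀ j → isTip j ≡ true → j ≡ m ℕ.+ spokeOf j ℕ.* m
  tip-shape zero    ()
  tip-shape (suc w) e = begin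
    suc w                             ≡⟨ divmod (suc w) ⟩
    suc w % m ℕ.+ (suc w / m) ℕ.* m   ≡⟨ cong (λ q → q ℕ.+ (suc w / m) ℕ.* m) (tip-divides w e) ⟩
    (suc w / m) ℕ.* m
      ≡⟨ cong (ℕ._* m) (sym (ℕP.suc-pred (suc w / m) ⦃ ℕ.>-nonZero positive ⦄)) ⟩
    m ℕ.+ spokeOf (suc w) ℕ.* m ∎
    where
    open ≡-Reasoning
    positive : 0 < suc w / m
    positive = ℕP.≤∧≢⇒< z≤n λ z →
      ℕP.0≢1+n (sym (trans (divmod (suc w)) (cong₂ (λ q t → q ℕ.+ t ℕ.* m) (tip-divides w e) (sym z))))

  next-tip : ∀ j → isTip j ≡ true → isTip (j ℕ.+ m) ≡ true
  next-tip j tip rewrite residue-shift j | ℕP.+-suc j m′ = ∧-elimʳ (not (j ≡ᵇ 0)) tip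

  next-tip-< : ∀ j → isEarlyTip j ≡ true → j ℕ.+ m < n
  next-tip-< j e = s≤s (subst (_≤ N) (ℕP.+-comm m j) (subst (λ z → m ℕ.+ z ≤ N) (sym shape)
    (subst (suc (suc S) ℕ.* m ≤_) (ℕP.*-comm r m)
      (ℕP.*-monoˡ-≤ m (ℕP.*-cancelʳ-< m (suc S) r (subst₂ _<_ shape (ℕP.*-comm m r) (proj₁ info)))))))
    where
    info = earlyTip-info j e
    S = spokeOf j
    shape = tip-shape j (proj₂ info)

  next-in-spoke : ∀ v → suc v % m ≢ 0 → suc v / m ≡ v / m
  next-in-spoke v not-tip with ℕP.m≤n⇒m<n∨m≡n (m%n<n v m)
  ... | inj₁ lt = trans (cong (λ z → suc z / m) (divmod v)) (div-unique (suc (v % m)) (v / m) lt)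
  ... | inj₂ eq = ⊥-elim (not-tip (begin
    suc v % m                              ≡⟨ cong (λ z → suc z % m) (divmod v) ⟩
    (suc (v % m) ℕ.+ (v / m) ℕ.* m) % m    ≡⟨ cong (λ q → (q ℕ.+ (v / m) ℕ.* m) % m) eq ⟩
    (0 ℕ.+ suc (v / m) ℕ.* m) % m          ≡⟨ mod-unique 0 (suc (v / m)) (s≤s z≤n) ⟩
    0 ∎))
    where open ≡-Reasoning

  inside-not-tip : ∀ T w → T ℕ.* m ≤ w → w < T ℕ.* m ℕ.+ m′ → suc w % m ≢ 0
  inside-not-tip T w lo hi tip =
    ℕP.0≢1+n (sym (trans (sym (mod-unique (suc d) T d<m′)) (trans (cong (_% m) (sym shape)) tip)))
    where
    d = w ∸ T ℕ.* m
    shape : suc w ≡ suc d ℕ.+ T ℕ.* m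
    shape = cong suc (sym (ℕP.m∸n+n≡m lo))
    d<m′ : suc d < m
    d<m′ = s≤s (ℕP.+-cancelˡ-< (T ℕ.* m) d m′
             (subst (_< T ℕ.* m ℕ.+ m′) (trans (sym (ℕP.m∸n+n≡m lo)) (ℕP.+-comm d (T ℕ.* m))) hi))

  tip-outside : ∀ T w → suc w % m ≡ 0 → w < T ℕ.* m ⊎ T ℕ.* m ℕ.+ m′ ≤ w
  tip-outside T w tip with w ℕP.<? T ℕ.* m | T ℕ.* m ℕ.+ m′ ℕP.≤? w
  ... | yes below | _        = inj₁ below
  ... | no _      | yes past = inj₂ past
  ... | no ¬below | no ¬past = ⊥-elim (inside-not-tip T w (ℕP.≮⇒≥ ¬below) (ℕP.≰⇒> ¬past) tip)

  sameSpoke-interval : ∀ T u → sameSpoke u (m′ ℕ.+ T ℕ.* m) ≡ indicator (T ℕ.* m) (T ℕ.* m ℕ.+ m) u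
  sameSpoke-interval T u rewrite div-unique m′ T ℕP.≤-refl with ℕP.<-cmp (u / m) T
  ... | tri< lt ne _ rewrite ≡ᵇ-false ne | <ᵇ-true (below-spoke {T} {u} lt) = refl
  ... | tri≈ _ refl _ rewrite ≡ᵇ-true {u / m} refl | <ᵇ-false {u} {(u / m) ℕ.* m} (m/n*n≤m u m)
                            | <ᵇ-true (subst (u <_) (ℕP.+-comm m ((u / m) ℕ.* m)) (within-spoke u)) = refl
  ... | tri> _ ne gt rewrite ≡ᵇ-false ne
                           | <ᵇ-false (ℕP.≤-trans (ℕP.m≤n+m (T ℕ.* m) m) (above-spoke {T} {u} gt))
                           | <ᵇ-false (subst (_≤ u) (ℕP.+-comm m (T ℕ.* m)) (above-spoke {T} {u} gt)) = refl

  -- Stage 1.  Subtracting from every inner column the next column of its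
  -- spoke leaves a · (e_j − e_{j+1}), because consecutive vertices of a
  -- spoke have the same neighbours.
  nextColumn : ℕ → ℕ → ℤ
  nextColumn j l = - δ l (suc j)

  inner-difference : ∀ j i → isInner j ≡ true → charMatrix i j - charMatrix i (suc j) ≡ a * pathColumn j i
  inner-difference zero    i       ()
  inner-difference (suc v) zero    _ = sym (ℤP.*-zeroʳ a)
  inner-difference (suc v) (suc u) e =
    trans (cong (λ z → (a * δ u v + sameSpoke u v) - (a * δ u (suc v) + z)) same)
      (cancel a (δ u v) (δ u (suc v)) (sameSpoke u v))
    where
    same : sameSpoke u (suc v) ≡ sameSpoke u v
    same = cong (λ z → if u / m ≡ᵇ z then + 1 else + 0) (next-in-spoke v (proj₂ (inner-info (suc v) e)))
    cancel : ∀ a d₁ d₂ b → (a * d₁ + b) - (a * d₂ + b) ≡ a * (d₁ - d₂)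
    cancel = solve-∀

  innerScale : ℕ → ℤ
  innerScale j = if isInner j then a else + 1

  differenced : Array
  differenced i j = if isInner j then pathColumn j i else charMatrix i j

  stage1 : ∀ i j → eliminate n isInner nextColumn charMatrix i j ≡ innerScale j * differenced i j
  stage1 i j with isInner j in inner
  ... | true  =
    trans (cong (λ t → charMatrix i j + t)
                (sum-minus-δ n (suc j) (charMatrix i) (s≤s (proj₁ (inner-info j inner)))))
          (inner-difference j i inner)
  ... | false = sym (ℤP.*-identityˡ _)

  det-differenced : detℕ n charMatrix ≡ prod n innerScale * detℕ n differenced
  det-differenced = begin
    detℕ n charMatrix
      ≡⟨ sym (det-eliminate n isInner nextColumn charMatrix later) ⟩
    detℕ n (eliminate n isInner nextColumn charMatrix)
      ≡⟨ det-cong n (λ i j _ _ → stage1 i j) ⟩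
    detℕ n (λ i j → innerScale j * differenced i j)
      ≡⟨ det-scale-columns n innerScale differenced ⟩
    prod n innerScale * detℕ n differenced ∎
    where
    open ≡-Reasoning
    later : ∀ K l → isInner K ≡ true → isInner l ≡ true → l ≤ K → nextColumn K l ≡ + 0
    later K l _ _ l≤K = cong -_ (δ-other (λ e → ℕP.<-irrefl e (s≤s l≤K)))

  -- Stage 3.  At the tip column j = m + T·m subtract the inner columns of
  -- spoke T (now path columns) with weights 1, 2, …, m′; the tip column
  -- becomes e_0 + c · e_j.
  rampWeight : ℕ → ℕ → ℤ
  rampWeight T = previous (ramp (T ℕ.* m) m′)

  tipCoef : ℕ → ℕ → ℤ
  tipCoef j l = - rampWeight (spokeOf j) l

  tipColumn : ℕ → ℕ → ℤ
  tipColumn j i = δ i 0 + c * δ i j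

  reduced : Array
  reduced i j = if isTip j then tipColumn j i else differenced i j

  rampWeight-tip : ∀ T l → isTip l ≡ true → rampWeight T l ≡ + 0
  rampWeight-tip T (suc w) e = ramp-outside (T ℕ.* m) m′ w (tip-outside T w (tip-divides w e))

  rampWeight-outer : ∀ T l → m ℕ.+ T ℕ.* m ≤ N → isInner l ≡ false → rampWeight T l ≡ + 0
  rampWeight-outer T zero    _     _ = refl
  rampWeight-outer T (suc w) bound e with suc w <ᵇ N in below | suc w % m ≡ᵇ 0 in tip
  ... | true  | true  = ramp-outside (T ℕ.* m) m′ w (tip-outside T w (≡ᵇ-sound tip))
  ... | false | _     = ramp-outside (T ℕ.* m) m′ w (inj₂ (subst (_≤ w) (ℕP.+-comm m′ (T ℕ.* m)) beyond))
    where beyond : m′ ℕ.+ T ℕ.* m ≤ w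
          beyond = ℕP.≤-pred (ℕP.≤-trans bound
                     (ℕP.≮⇒≥ λ p → true≢false (trans (sym (<ᵇ-true p)) below)))
  rampWeight-outer T (suc w) bound () | true | false

  ramp-sees-path : ∀ T → m ℕ.+ T ℕ.* m ≤ N → ∀ i l →
    rampWeight T l * differenced i l ≡ rampWeight T l * pathColumn l i
  ramp-sees-path T bound i l with isInner l in inner
  ... | true  = refl
  ... | false rewrite rampWeight-outer T l bound inner = refl

  tip-row : ∀ T i →
    charMatrix i (m ℕ.+ T ℕ.* m) - (rampWeight T i - previous (rampWeight T) i) ≡ tipColumn (m ℕ.+ T ℕ.* m) i
  tip-row T zero    = sym (cong (λ t → + 1 + t) (ℤP.*-zeroʳ c))
  tip-row T (suc u) = begin
    (a * δ u v + sameSpoke u v) - (ramp s m′ u - previous (ramp s m′) u)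
      ≡⟨ cong₂ (λ y z → (a * δ u v + y) - z) (sameSpoke-interval T u) (ramp-step s m′ u) ⟩
    (a * δ u v + indicator s (s ℕ.+ m) u) - (indicator s (s ℕ.+ m) u - + m * δ u (s ℕ.+ m′))
      ≡⟨ cong (λ d → (a * δ u v + indicator s (s ℕ.+ m) u) - (indicator s (s ℕ.+ m) u - + m * d))
           (cong (δ u) (ℕP.+-comm s m′)) ⟩
    (a * δ u v + indicator s (s ℕ.+ m) u) - (indicator s (s ℕ.+ m) u - + m * δ u v)
      ≡⟨ collect a (+ m) (δ u v) _ ⟩
    + 0 + (a + + m) * δ u v
      ≡⟨ cong (λ z → + 0 + z * δ u v) (sym c≡a+m) ⟩
    + 0 + c * δ u v ∎
    where
    open ≡-Reasoning
    s v : ℕ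
    s = T ℕ.* m
    v = m′ ℕ.+ T ℕ.* m
    collect : ∀ a y d I → (a * d + I) - (I - y * d) ≡ + 0 + (a + y) * d
    collect = solve-∀

  stage3 : ∀ i j → i < n → j < n → eliminate n isTip tipCoef differenced i j ≡ reduced i j
  stage3 i j i<n j<n with isTip j in tip
  ... | false = refl
  ... | true  = begin
    differenced i j + sum n (λ l → - rampWeight S l * differenced i l)
      ≡⟨ cong₂ _+_ (cong (λ b → if b then pathColumn j i else charMatrix i j) (tip-not-inner j tip))
                   ramp-sum ⟩
    charMatrix i j - (rampWeight S i - previous (rampWeight S) i)
      ≡⟨ cong (λ z → charMatrix i z - (rampWeight S i - previous (rampWeight S) i)) shape ⟩
    charMatrix i (m ℕ.+ S ℕ.* m) - (rampWeight S i - previous (rampWeight S) i)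
      ≡⟨ tip-row S i ⟩
    tipColumn (m ℕ.+ S ℕ.* m) i
      ≡⟨ cong (λ z → tipColumn z i) (sym shape) ⟩
    tipColumn j i ∎
    where
    open ≡-Reasoning
    S = spokeOf j
    shape = tip-shape j tip
    bound : m ℕ.+ S ℕ.* m ≤ N
    bound = ℕP.≤-pred (subst (_< n) shape j<n)
    ramp-sum : sum n (λ l → - rampWeight S l * differenced i l) ≡ - (rampWeight S i - previous (rampWeight S) i)
    ramp-sum = begin
      sum n (λ l → - rampWeight S l * differenced i l)
        ≡⟨ sum-cong n (λ l _ → trans (sym (ℤP.neg-distribˡ-* (rampWeight S l) (differenced i l)))
                                     (cong -_ (ramp-sees-path S bound i l))) ⟩
      sum n (λ l → - (rampWeight S l * pathColumn l i))
        ≡⟨ sum-neg n (λ l → rampWeight S l * pathColumn l i) ⟩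
      - sum n (λ l → rampWeight S l * pathColumn l i)
        ≡⟨ cong -_ (telescope n (rampWeight S) i i<n) ⟩
      - (rampWeight S i - previous (rampWeight S) i) ∎

  det-reduced : detℕ n differenced ≡ detℕ n reduced
  det-reduced = trans (sym (det-eliminate n isTip tipCoef differenced avoids-tips)) (det-cong n stage3)
    where
    avoids-tips : ∀ K l → isTip K ≡ true → isTip l ≡ true → l ≤ K → tipCoef K l ≡ + 0
    avoids-tips K l _ tip _ = cong -_ (rampWeight-tip (spokeOf K) l tip)

  -- Stage 4.  At every early tip j subtract the tip column j + m of the next
  -- spoke and c times the inner (path) columns of that spoke; what is left is
  -- c · (e_j − e_{j+1}).
  stepWeight : ℕ → ℕ → ℤ
  stepWeight j = previous (indicator j (j ℕ.+ m′))

  earlyTipCoef : ℕ → ℕ → ℤ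
  earlyTipCoef j l = - δ l (j ℕ.+ m) - c * stepWeight j l

  step-sees-path : ∀ j → isEarlyTip j ≡ true → ∀ i l →
    stepWeight j l * reduced i l ≡ stepWeight j l * pathColumn l i
  step-sees-path j e i zero    = refl
  step-sees-path j e i (suc w) with w ℕP.<? j | j ℕ.+ m′ ℕP.≤? w
  ... | yes before | _        rewrite indicator-outside j (j ℕ.+ m′) w (ℕP.m≤m+n j m′) (inj₁ before) = refl
  ... | no _       | yes past rewrite indicator-outside j (j ℕ.+ m′) w (ℕP.m≤m+n j m′) (inj₂ past)   = refl
  ... | no ¬before | no ¬past = inner-column not-tip inside-N
    where
    inner-column : suc w % m ≢ 0 → suc w < N →
      stepWeight j (suc w) * reduced i (suc w) ≡ stepWeight j (suc w) * pathColumn (suc w) i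
    inner-column nt lt rewrite ≡ᵇ-false nt | <ᵇ-true lt = refl
    shape = tip-shape j (proj₂ (earlyTip-info j e))
    not-tip : suc w % m ≢ 0
    not-tip = inside-not-tip (suc (spokeOf j)) w (subst (_≤ w) shape (ℕP.≮⇒≥ ¬before))
                (subst (λ z → w < z ℕ.+ m′) shape (ℕP.≰⇒> ¬past))
    inside-N : suc w < N
    inside-N = ℕP.≤-trans (s≤s (ℕP.≰⇒> ¬past))
                          (subst (_≤ N) (ℕP.+-suc j m′) (ℕP.≤-pred (next-tip-< j e)))

  step-difference : ∀ j i → stepWeight j i - previous (stepWeight j) i ≡ δ i (suc j) - δ i (j ℕ.+ m)
  step-difference j zero    = sym (cong (λ z → + 0 - δ 0 z) (ℕP.+-suc j m′))
  step-difference j (suc u) =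
    trans (indicator-step j (j ℕ.+ m′) u (ℕP.m≤m+n j m′))
          (sym (cong (λ z → δ u j - δ (suc u) z) (ℕP.+-suc j m′)))

  tipScale : ℕ → ℤ
  tipScale j = if isEarlyTip j then c else + 1

  bridged : Array
  bridged i j = if isEarlyTip j then pathColumn j i else reduced i j

  stage4 : ∀ i j → i < n → j < n → eliminate n isEarlyTip earlyTipCoef reduced i j ≡ tipScale j * bridged i j
  stage4 i j i<n j<n with isEarlyTip j in early
  ... | false = sym (ℤP.*-identityˡ _)
  ... | true  = begin
    reduced i j + sum n (λ l → earlyTipCoef j l * reduced i l)
      ≡⟨ cong (λ t → reduced i j + t)
           (trans (sum-cong n (λ l _ → split l)) (sum-+ n next-tip-part steps-part)) ⟩
    reduced i j + (sum n next-tip-part + sum n steps-part)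
      ≡⟨ cong₂ (λ y z → reduced i j + (y + z))
           (sum-minus-δ n (j ℕ.+ m) (reduced i) (next-tip-< j early)) steps ⟩
    reduced i j + (- reduced i (j ℕ.+ m) + - (c * (δ i (suc j) - δ i (j ℕ.+ m))))
      ≡⟨ cong₂ (λ y z → y + (- z + - (c * (δ i (suc j) - δ i (j ℕ.+ m)))))
           (tip-value j tip) (tip-value (j ℕ.+ m) (next-tip j tip)) ⟩
    tipColumn j i + (- tipColumn (j ℕ.+ m) i + - (c * (δ i (suc j) - δ i (j ℕ.+ m))))
      ≡⟨ collapse (δ i 0) c (δ i j) (δ i (suc j)) (δ i (j ℕ.+ m)) ⟩
    c * pathColumn j i ∎
    where
    open ≡-Reasoning
    tip = proj₂ (earlyTip-info j early)
    next-tip-part steps-part : ℕ → ℤ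
    next-tip-part l = - δ l (j ℕ.+ m) * reduced i l
    steps-part l = - (c * (stepWeight j l * reduced i l))
    split : ∀ l → earlyTipCoef j l * reduced i l ≡ next-tip-part l + steps-part l
    split l = distribute (δ l (j ℕ.+ m)) c (stepWeight j l) (reduced i l)
      where distribute : ∀ d c w g → (- d - c * w) * g ≡ - d * g + - (c * (w * g))
            distribute = solve-∀
    steps : sum n steps-part ≡ - (c * (δ i (suc j) - δ i (j ℕ.+ m)))
    steps = begin
      sum n steps-part
        ≡⟨ sum-neg n (λ l → c * (stepWeight j l * reduced i l)) ⟩
      - sum n (λ l → c * (stepWeight j l * reduced i l))
        ≡⟨ cong -_ (sum-scale n c (λ l → stepWeight j l * reduced i l)) ⟩
      - (c * sum n (λ l → stepWeight j l * reduced i l))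
        ≡⟨ cong (λ z → - (c * z)) (sum-cong n (λ l _ → step-sees-path j early i l)) ⟩
      - (c * sum n (λ l → stepWeight j l * pathColumn l i))
        ≡⟨ cong (λ z → - (c * z)) (trans (telescope n (stepWeight j) i i<n) (step-difference j i)) ⟩
      - (c * (δ i (suc j) - δ i (j ℕ.+ m))) ∎
    tip-value : ∀ j → isTip j ≡ true → reduced i j ≡ tipColumn j i
    tip-value j t rewrite t = refl
    collapse : ∀ z c d₀ d₁ d₂ → (z + c * d₀) + (- (z + c * d₂) + - (c * (d₁ - d₂))) ≡ c * (d₀ - d₁)
    collapse = solve-∀

  det-bridged : detℕ n reduced ≡ prod n tipScale * detℕ n bridged
  det-bridged = begin
    detℕ n reduced
      ≡⟨ sym (det-eliminate n isEarlyTip earlyTipCoef reduced later) ⟩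
    detℕ n (eliminate n isEarlyTip earlyTipCoef reduced)
      ≡⟨ det-cong n stage4 ⟩
    detℕ n (λ i j → tipScale j * bridged i j)
      ≡⟨ det-scale-columns n tipScale bridged ⟩
    prod n tipScale * detℕ n bridged ∎
    where
    open ≡-Reasoning
    later : ∀ K l → isEarlyTip K ≡ true → isEarlyTip l ≡ true → l ≤ K → earlyTipCoef K l ≡ + 0
    later K l _ _ l≤K = trans (cong₂ (λ d w → - d - c * w) (δ-other beyond) (before l l≤K)) (vanish c)
      where
      beyond : l ≢ K ℕ.+ m
      beyond e = ℕP.<-irrefl e
        (ℕP.≤-<-trans l≤K (subst (K <_) (sym (ℕP.+-suc K m′)) (s≤s (ℕP.m≤m+n K m′))))
      before : ∀ l → l ≤ K → stepWeight K l ≡ + 0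
      before zero    _   = refl
      before (suc w) w<K = indicator-outside K (K ℕ.+ m′) w (ℕP.m≤m+n K m′) (inj₁ w<K)
      vanish : ∀ c → - + 0 - c * + 0 ≡ + 0
      vanish = solve-∀

  K₀ : ℕ
  K₀ = r′ ℕ.+ m′ ℕ.* suc r′

  N-is-tip : (N % m ≡ᵇ 0) ≡ true
  N-is-tip = ≡ᵇ-true (trans (cong (_% m) (ℕP.*-comm m r)) (m*n%n≡0 r m))

  bridged-path : ∀ i j → 1 ≤ j → j ≤ K₀ → bridged i j ≡ pathColumn j i
  bridged-path i (suc w) _ p with suc w % m ≡ᵇ 0
  ... | true  rewrite <ᵇ-true {suc w} {N} (s≤s p) = refl
  ... | false rewrite <ᵇ-true {suc w} {N} (s≤s p) = refl

  bridged-last : ∀ i → bridged i N ≡ tipColumn N i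
  bridged-last i rewrite <ᵇ-self K₀ | N-is-tip = refl

  det-bridged-value : detℕ n bridged ≡ (x - + N) * c - + 1 * + N
  det-bridged-value = begin
    detℕ n bridged
      ≡⟨ det-path-interior K₀ bridged bridged-path ⟩
    bridged 0 0 * sum N (λ i → bridged (suc i) N) - bridged 0 N * sum N (λ i → bridged (suc i) 0)
      ≡⟨ cong₂ (λ y z → (x - + N) * y - z * sum N (λ i → bridged (suc i) 0)) last-column top-right ⟩
    (x - + N) * c - + 1 * sum N (λ _ → + 1)
      ≡⟨ cong (λ z → (x - + N) * c - + 1 * z) (sum-ones N) ⟩
    (x - + N) * c - + 1 * + N ∎
    where
    open ≡-Reasoning
    last-column : sum N (λ i → bridged (suc i) N) ≡ c
    last-column =
      trans (sum-cong N λ i _ →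
               trans (bridged-last (suc i)) (trans (ℤP.+-identityˡ _) (ℤP.*-comm c (δ i K₀))))
            (sum-δ N K₀ (λ _ → c) (ℕP.n<1+n K₀))
    top-right : bridged 0 N ≡ + 1
    top-right = trans (bridged-last 0) (cong (λ t → + 1 + t) (ℤP.*-zeroʳ c))

  -- The scaling factors: a for each of the m′ inner vertices of every spoke,
  -- c for every spoke but the final one.  Both products are periodic in the
  -- residue modulo m.
  residueScale : ℕ → ℤ
  residueScale j = if j % m ≡ᵇ 0 then + 1 else a

  prod-innerScale : prod n innerScale ≡ a ^ (m′ ℕ.* r)
  prod-innerScale = begin
    prod n innerScale                 ≡⟨ prod-snoc N innerScale ⟩
    prod N innerScale * innerScale N  ≡⟨ cong₂ _*_ (prod-cong N below-N) last ⟩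
    prod N residueScale * + 1         ≡⟨ ℤP.*-identityʳ _ ⟩
    prod N residueScale               ≡⟨ cong (λ z → prod z residueScale) (ℕP.*-comm m r) ⟩
    prod (r ℕ.* m) residueScale       ≡⟨ prod-periodic m r residueScale periodic ⟩
    prod m residueScale ^ r           ≡⟨ cong (_^ r) one-spoke ⟩
    (a ^ m′) ^ r                      ≡⟨ ℤP.^-*-assoc a m′ r ⟩
    a ^ (m′ ℕ.* r) ∎
    where
    open ≡-Reasoning
    below-N : ∀ j → j < N → innerScale j ≡ residueScale j
    below-N j p rewrite <ᵇ-true p with j % m ≡ᵇ 0
    ... | true  = refl
    ... | false = refl
    last : innerScale N ≡ + 1
    last rewrite <ᵇ-self K₀ = refl
    periodic : ∀ j → residueScale (m ℕ.+ j) ≡ residueScale j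
    periodic j = cong (λ z → if z ≡ᵇ 0 then + 1 else a) (trans (cong (_% m) (ℕP.+-comm m j)) (residue-shift j))
    one-spoke : prod m residueScale ≡ a ^ m′
    one-spoke = trans (ℤP.*-identityˡ _) (trans (prod-cong m′ inner) (prod-const m′ a))
      where inner : ∀ j → j < m′ → residueScale (suc j) ≡ a
            inner j p rewrite small-residue (suc j) (s≤s p) = refl

  tipOfNext : ℕ → ℤ
  tipOfNext j = if suc j % m ≡ᵇ 0 then c else + 1

  prod-tipScale : prod n tipScale ≡ c ^ r′
  prod-tipScale = begin
    prod n tipScale
      ≡⟨ ℤP.*-identityˡ _ ⟩
    prod N (tipScale ∘ suc)
      ≡⟨ cong (λ z → prod z (tipScale ∘ suc)) N≡ ⟩
    prod (r′ ℕ.* m ℕ.+ m) (tipScale ∘ suc)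
      ≡⟨ prod-split (r′ ℕ.* m) m (tipScale ∘ suc) ⟩
    prod (r′ ℕ.* m) (tipScale ∘ suc) * prod m (λ p → tipScale (suc (r′ ℕ.* m ℕ.+ p)))
      ≡⟨ cong₂ _*_ (prod-cong (r′ ℕ.* m) early) (prod-cong m final) ⟩
    prod (r′ ℕ.* m) tipOfNext * prod m (λ _ → + 1)
      ≡⟨ cong₂ _*_ (prod-periodic m r′ tipOfNext periodic) (trans (prod-const m (+ 1)) (ℤP.^-zeroˡ m)) ⟩
    prod m tipOfNext ^ r′ * + 1
      ≡⟨ trans (ℤP.*-identityʳ _) (cong (_^ r′) one-spoke) ⟩
    c ^ r′ ∎
    where
    open ≡-Reasoning
    N≡ : N ≡ r′ ℕ.* m ℕ.+ m
    N≡ = trans (ℕP.*-comm m r) (ℕP.+-comm m (r′ ℕ.* m))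
    early : ∀ j → j < r′ ℕ.* m → tipScale (suc j) ≡ tipOfNext j
    early j p rewrite <ᵇ-true {suc j} {N} (subst (suc (suc j) ≤_) (sym N≡)
                        (ℕP.≤-trans (s≤s p) (ℕP.m<m+n (r′ ℕ.* m) (s≤s z≤n)))) = refl
    final : ∀ p → p < m → tipScale (suc (r′ ℕ.* m ℕ.+ p)) ≡ + 1
    final p (s≤s p≤m′) with ℕP.m≤n⇒m<n∨m≡n p≤m′
    ... | inj₂ refl = subst (λ j → tipScale j ≡ + 1) (trans N≡ (ℕP.+-suc (r′ ℕ.* m) m′)) last
      where last : tipScale N ≡ + 1
            last rewrite <ᵇ-self K₀ = refl
    ... | inj₁ p<m′ =
      inner-vertex (trans (cong (λ z → suc z % m) (ℕP.+-comm (r′ ℕ.* m) p))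
                          (mod-unique (suc p) r′ (s≤s p<m′)))
      where inner-vertex : suc (r′ ℕ.* m ℕ.+ p) % m ≡ suc p → tipScale (suc (r′ ℕ.* m ℕ.+ p)) ≡ + 1
            inner-vertex e rewrite e = cong (λ b → if b then c else + 1) (∧-zeroʳ _)
    periodic : ∀ j → tipOfNext (m ℕ.+ j) ≡ tipOfNext j
    periodic j = cong (λ z → if z ≡ᵇ 0 then c else + 1)
      (trans (cong (_% m) (trans (sym (ℕP.+-suc m j)) (ℕP.+-comm m (suc j)))) (residue-shift (suc j)))
    one-spoke : prod m tipOfNext ≡ c
    one-spoke = trans (prod-snoc m′ tipOfNext)
      (trans (cong₂ _*_ (trans (prod-cong m′ inner) (trans (prod-const m′ (+ 1)) (ℤP.^-zeroˡ m′))) tip)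
             (ℤP.*-identityˡ c))
      where
      inner : ∀ j → j < m′ → tipOfNext j ≡ + 1
      inner j p rewrite small-residue (suc j) (s≤s p) = refl
      tip : tipOfNext m′ ≡ c
      tip = cong (λ z → if z ≡ᵇ 0 then c else + 1) (n%n≡0 m)

  factorise : ∀ A C x M → A * (C * ((x - M) * (x - + 1) - + 1 * M)) ≡ x * (x - (+ 1 + M)) * C * A
  factorise = solve-∀

proposition2p3 : (k r : ℕ) → 2 ≤ k → 1 ≤ r → (x : ℤ) →
    charPoly (laplacian (star k r)) x
      ≡ x * (x - + starVertices k r) * (x - + 1) ^ (r ∸ 1)
          * (x - + k) ^ ((k ∸ 2) Data.Nat.* r)
proposition2p3 (suc (suc m′)) (suc r′) (s≤s (s≤s z≤n)) (s≤s z≤n) x = begin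
  charPoly (laplacian H) x
    ≡⟨ charPoly≡detℕ ⟩
  detℕ n charMatrix
    ≡⟨ det-differenced ⟩
  prod n innerScale * detℕ n differenced
    ≡⟨ cong (prod n innerScale *_) (trans det-reduced det-bridged) ⟩
  prod n innerScale * (prod n tipScale * detℕ n bridged)
    ≡⟨ cong₂ _*_ prod-innerScale (cong₂ _*_ prod-tipScale det-bridged-value) ⟩
  a ^ (m′ ℕ.* r) * (c ^ r′ * ((x - + N) * c - + 1 * + N))
    ≡⟨ factorise (a ^ (m′ ℕ.* r)) (c ^ r′) x (+ N) ⟩
  x * (x - + n) * c ^ r′ * a ^ (m′ ℕ.* r) ∎
  where
  open Star m′ r′ x
  open ≡-Reasoning
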